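{- Let $p>3$ be a prime. For an integer $r$ with $|r|<2\sqrt p$ define \[ c_{r,p}=\begin{cases} 1/2, & \text{if } r^2-4p=-4\alpha^2 \text{ for some } \alpha\in\mathbb{Z},\\ 2/3, & \text{if } r^2-4p=-3\alpha^2 \text{ for some } \alpha\in\mathbb{Z},\\ 0, & \text{otherwise}. \end{cases} \] Then \[ \sum_{\substack{r\in\mathbb{Z},\ |r|<2\sqrt p,\\ r\equiv 0\pmod 2}}c_{r,p} =\begin{cases} 10/3, & p\equiv 1\pmod{12},\\ 2, & p\equiv 5\pmod{12},\\ 4/3, & p\equiv 7\pmod{12},\\ 0, & p\equiv 11\pmod{12}. \end{cases} \] -}

module Defs where

open import Data.Nat as ℕ using (ℕ)
open import Data.Nat.Divisibility using (_∣?_)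
open import Data.Integer as ℤ using (ℤ; +_; -_; _-_; _*_; _<_; ∣_∣)
open import Data.Integer.Properties using (_≟_; _<?_)
open import Data.Rational as ℚ using (ℚ; 0ℚ; _/_)
open import Data.List using (List; map; upTo; filter; foldr)
open import Data.List.Relation.Unary.Any using (any?)
open import Relation.Nullary.Decidable using (does)
open import Data.Bool using (if_then_else_)

intRange : ℕ → List ℤ
intRange N = map (λ i → + i - + N) (upTo (2 ℕ.* N ℕ.+ 1))

sq : ℤ → ℤ
sq r = r * r

-- "r² - 4p = -k α² for some α ∈ ℤ", decided by searching α ∈ [-4p, 4p].
-- This search is exhaustive: any such α satisfies |α| ≤ α² ≤ 4p
-- (for k ≥ 1 and r² ≥ 0), so no witness is missed.
hasForm : ℕ → ℕ → ℤ → Data.Bool.Bool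
hasForm k p r =
  does (any? (λ α → sq r - + (4 ℕ.* p) ≟ - (+ k * sq α)) (intRange (4 ℕ.* p)))

c : ℤ → ℕ → ℚ
c r p = if hasForm 4 p r then + 1 / 2
        else if hasForm 3 p r then + 2 / 3
        else 0ℚ

-- |r| < 2√p  ⇔  r² < 4p  (both sides nonnegative).
-- Condition on r in the sum: r² < 4p and r ≡ 0 (mod 2).
-- All such r lie in [-4p, 4p], so filtering intRange (4p) enumerates them exactly once.
admissible : ℕ → List ℤ
admissible p = filter (λ r → 2 ∣? ∣ r ∣) (filter (λ r → sq r <? + (4 ℕ.* p)) (intRange (4 ℕ.* p)))

sumℚ : List ℚ → ℚ
sumℚ = foldr ℚ._+_ 0ℚ

S : ℕ → ℚ
S p = sumℚ (map (λ r → c r p) (admissible p))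

{-# OPTIONS --safe #-}
-- Writing r = 2s, the summand c_{r,p} is 1/2 exactly when s² + α² = p for some α, and 2/3 exactly
-- when s² + 3β² = p (the α of the definition is then 2β); the two never happen for the same s, as
-- α² = 3β² forces α = 0 and p is not a square.  A prime p > 3 is s² + α² iff p ≡ 1 (mod 4), and
-- s² + 3β² iff p ≡ 1 (mod 3), uniquely up to order and signs.  Necessity is a congruence mod 4 resp. 3.
-- For sufficiency, -1 resp. -3 is a square mod p: x^((p-1)/k) - 1 has too few roots to vanish on
-- 1, ..., (p-1)/k + 1 (its ((p-1)/k)-th finite difference is ((p-1)/k)!), and Fermat's little theorem
-- turns a non-root into a square root of -1, resp. (via y² + y + 1) of -3; Thue's lemma then gives the
-- representation.  Uniqueness comes from p ∣ (ac + kbd)(ad + bc).  So for p ≡ 1 (mod 4) the values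
-- r = ±2a, ±2b contribute 1/2 each and for p ≡ 1 (mod 3) the values r = ±2a contribute 2/3 each.
module Submission where

open import Defs
open import Data.Nat using (ℕ; _<_; _%_)
open import Data.Nat.Primality using (Prime)
open import Data.Integer using (+_)
open import Data.Rational using (_/_; 0ℚ)
open import Data.Product using (_×_; _,_)
open import Relation.Binary.PropositionalEquality using (_≡_)

-- Sums of squares: congruences, uniqueness, descent
module _ where

  open import Data.Nat as ℕ using (ℕ; zero; suc; z≤n; s≤s; NonZero; _+_; _*_; _%_; _<_; _≤_; ∣_-_∣)
  open import Data.Nat.Properties
  open import Data.Nat.Divisibility using (_∣_; divides; m∣m*n; m%n≡0⇒n∣m; ∣⇒≤)
  open import Data.Nat.DivMod using (%-distribˡ-+; %-distribˡ-*; %-remove-+ʳ; m%n<n; m≡m%n+[m/n]*n; m∣n⇒o%n%m≡o%m)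
  open import Data.Nat.Induction using (<-rec)
  open import Data.Nat.Primality using (Prime; prime?; euclidsLemma; prime⇒irreducible; ¬prime[1]; prime⇒nonZero; prime⇒nonTrivial)
  import Data.Nat.Tactic.RingSolver as ℕ-Solver
  open import Data.Product using (∃; _×_; _,_; proj₁; proj₂)
  open import Data.Sum using (_⊎_; inj₁; inj₂; [_,_]′)
  open import Data.Empty using (⊥; ⊥-elim)
  open import Function using (id)
  open import Relation.Nullary.Decidable using (from-yes)
  open import Relation.Binary.PropositionalEquality

  private
    variable
      p : ℕ

  m*m≡0⇒m≡0 : ∀ m → m * m ≡ 0 → m ≡ 0
  m*m≡0⇒m≡0 zero _ = refl

  m≤m*m : ∀ m → m ≤ m * m
  m≤m*m zero    = z≤n
  m≤m*m (suc m) = m≤m*n (suc m) (suc m)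

  a²+b²≡n⇒a²+1b²≡n : ∀ a b {n} → a * a + b * b ≡ n → a * a + 1 * (b * b) ≡ n
  a²+b²≡n⇒a²+1b²≡n a b eq = trans (cong (λ x → a * a + x) (*-identityˡ (b * b))) eq

  ∣m-n∣²+2mn≡m²+n² : ∀ m n → ∣ m - n ∣ * ∣ m - n ∣ + 2 * (m * n) ≡ m * m + n * n
  ∣m-n∣²+2mn≡m²+n² m n with ≤-total m n
  ... | inj₁ m≤n with m≤n⇒∃[o]m+o≡n m≤n
  ...   | k , refl rewrite ∣m-m+n∣≡n m k = identity m k
    where
    identity : ∀ m k → k * k + 2 * (m * (m + k)) ≡ m * m + (m + k) * (m + k)
    identity = ℕ-Solver.solve-∀
  ∣m-n∣²+2mn≡m²+n² m n | inj₂ n≤m with m≤n⇒∃[o]m+o≡n n≤m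
  ...   | k , refl rewrite ∣-∣-comm (n + k) n | ∣m-m+n∣≡n n k = identity n k
    where
    identity : ∀ n k → k * k + 2 * ((n + k) * n) ≡ (n + k) * (n + k) + n * n
    identity = ℕ-Solver.solve-∀

  %≡⇒≡+* : ∀ {n d r} .{{_ : NonZero d}} → n % d ≡ r → n ≡ r + d * (n ℕ./ d)
  %≡⇒≡+* {n} {d} refl = trans (m≡m%n+[m/n]*n n d) (cong (λ x → n % d + x) (*-comm (n ℕ./ d) d))

  %12⇒%d : ∀ {p r} d .{{_ : NonZero d}} → d ∣ 12 → p % 12 ≡ r → p % d ≡ r % d
  %12⇒%d {p} d d∣12 p%12≡r = trans (sym (m∣n⇒o%n%m≡o%m d 12 p d∣12)) (cong (_% d) p%12≡r)

  %12⇒%4 : ∀ {p r} → p % 12 ≡ r → p % 4 ≡ r % 4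
  %12⇒%4 {p} = %12⇒%d {p} 4 (divides 3 refl)

  %12⇒%3 : ∀ {p r} → p % 12 ≡ r → p % 3 ≡ r % 3
  %12⇒%3 {p} = %12⇒%d {p} 3 (divides 4 refl)

  isqrt : ∀ n → ∃ λ m → m * m ≤ n × n < suc m * suc m
  isqrt zero = 0 , z≤n , s≤s z≤n
  isqrt (suc n) with isqrt n
  ... | m , m²≤n , n<[1+m]² with m≤n⇒m<n∨m≡n n<[1+m]²
  ...   | inj₁ 1+n<[1+m]² = m , m≤n⇒m≤1+n m²≤n , 1+n<[1+m]²
  ...   | inj₂ 1+n≡[1+m]² = suc m , ≤-reflexive (sym 1+n≡[1+m]²) ,
            subst (_< suc (suc m) * suc (suc m)) (sym 1+n≡[1+m]²) (*-mono-< (n<1+n (suc m)) (n<1+n (suc m)))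

  boundedMultiple : ∀ {p N} d → p ∣ N → 0 < N → N < suc d * p → ∃ λ q → N ≡ q * p × 0 < q × q ≤ d
  boundedMultiple {p} d (divides q N≡qp) 0<N N<[1+d]p =
    q , N≡qp , n≢0⇒n>0 (λ q≡0 → <⇒≢ 0<N (sym (trans N≡qp (cong (_* p) q≡0)))) ,
    ≤-pred (*-cancelʳ-< p q (suc d) (subst (_< suc d * p) N≡qp N<[1+d]p))

  square%4 : ∀ a → a * a % 4 ≡ 0 ⊎ a * a % 4 ≡ 1
  square%4 a = subst (λ r → r ≡ 0 ⊎ r ≡ 1) (sym (%-distribˡ-* a a 4)) (residue (a % 4) (m%n<n a 4))
    where
    residue : ∀ r → r < 4 → r * r % 4 ≡ 0 ⊎ r * r % 4 ≡ 1
    residue 0 _ = inj₁ refl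
    residue 1 _ = inj₂ refl
    residue 2 _ = inj₁ refl
    residue 3 _ = inj₂ refl
    residue (suc (suc (suc (suc _)))) (s≤s (s≤s (s≤s (s≤s ()))))

  square%3 : ∀ a → a * a % 3 ≡ 0 ⊎ a * a % 3 ≡ 1
  square%3 a = subst (λ r → r ≡ 0 ⊎ r ≡ 1) (sym (%-distribˡ-* a a 3)) (residue (a % 3) (m%n<n a 3))
    where
    residue : ∀ r → r < 3 → r * r % 3 ≡ 0 ⊎ r * r % 3 ≡ 1
    residue 0 _ = inj₁ refl
    residue 1 _ = inj₂ refl
    residue 2 _ = inj₂ refl
    residue (suc (suc (suc _))) (s≤s (s≤s (s≤s ())))

  a²+b²%4≢3 : ∀ a b → (a * a + b * b) % 4 ≢ 3
  a²+b²%4≢3 a b eq = residues (square%4 a) (square%4 b) (trans (sym (%-distribˡ-+ (a * a) (b * b) 4)) eq)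
    where
    residues : ∀ {x y} → x ≡ 0 ⊎ x ≡ 1 → y ≡ 0 ⊎ y ≡ 1 → (x + y) % 4 ≢ 3
    residues (inj₁ refl) (inj₁ refl) ()
    residues (inj₁ refl) (inj₂ refl) ()
    residues (inj₂ refl) (inj₁ refl) ()
    residues (inj₂ refl) (inj₂ refl) ()

  a²+3b²%4≢2 : ∀ a b → (a * a + 3 * (b * b)) % 4 ≢ 2
  a²+3b²%4≢2 a b eq = residues (square%4 a) (square%4 b) (begin
    (a * a % 4 + 3 * (b * b % 4) % 4) % 4 ≡⟨ cong (λ z → (a * a % 4 + z) % 4) (%-distribˡ-* 3 (b * b) 4) ⟨
    (a * a % 4 + 3 * (b * b) % 4) % 4     ≡⟨ %-distribˡ-+ (a * a) (3 * (b * b)) 4 ⟨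
    (a * a + 3 * (b * b)) % 4             ≡⟨ eq ⟩
    2                                     ∎)
    where
    open ≡-Reasoning
    residues : ∀ {x y} → x ≡ 0 ⊎ x ≡ 1 → y ≡ 0 ⊎ y ≡ 1 → (x + 3 * y % 4) % 4 ≢ 2
    residues (inj₁ refl) (inj₁ refl) ()
    residues (inj₁ refl) (inj₂ refl) ()
    residues (inj₂ refl) (inj₁ refl) ()
    residues (inj₂ refl) (inj₂ refl) ()

  a²+3b²%3≢2 : ∀ a b → (a * a + 3 * (b * b)) % 3 ≢ 2
  a²+3b²%3≢2 a b eq with square%3 a | trans (sym (%-remove-+ʳ (a * a) (m∣m*n (b * b)))) eq
  ... | inj₁ eq₀ | eq₂ = 0≢1+n (trans (sym eq₀) eq₂)
  ... | inj₂ eq₁ | eq₂ = 0≢1+n (suc-injective (trans (sym eq₁) eq₂))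

  prime⇒1<p : Prime p → 1 < p
  prime⇒1<p {p} pp = ℕ.nonTrivial⇒n>1 p {{prime⇒nonTrivial pp}}

  prime≢square : Prime p → ∀ m → p ≢ m * m
  prime≢square {p} pp m p≡m² with prime⇒irreducible pp {m} (divides m p≡m²)
  ... | inj₁ refl = ¬prime[1] (subst Prime p≡m² pp)
  ... | inj₂ refl = <-irrefl 1≡p (prime⇒1<p pp)
    where
    1≡p : 1 ≡ p
    1≡p = *-cancelʳ-≡ 1 p p {{prime⇒nonZero pp}} (trans (*-identityˡ p) p≡m²)

  prime>2⇒odd : Prime p → 2 < p → p % 2 ≡ 1
  prime>2⇒odd {p} pp 2<p with p % 2 in eq | m%n<n p 2
  ... | 0 | _ with prime⇒irreducible pp (m%n≡0⇒n∣m p 2 eq)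
  ...   | inj₁ ()
  ...   | inj₂ refl = ⊥-elim (<-irrefl refl 2<p)
  prime>2⇒odd {p} pp 2<p | 1 | _ = refl
  prime>2⇒odd {p} pp 2<p | suc (suc _) | s≤s (s≤s ())

  prime%d≡1⇒p≡1+dt : Prime p → ∀ d .{{_ : NonZero d}} → p % d ≡ 1 → p ≡ 1 + d * (p ℕ./ d) × 0 < p ℕ./ d
  prime%d≡1⇒p≡1+dt {p} pp d p%d≡1 =
    p≡1+dt , n≢0⇒n>0 λ t≡0 → ¬prime[1] (subst Prime (trans p≡1+dt (trans (cong (λ t → 1 + d * t) t≡0) (cong suc (*-zeroʳ d)))) pp)
    where
    p≡1+dt : p ≡ 1 + d * (p ℕ./ d)
    p≡1+dt = %≡⇒≡+* p%d≡1

  primeBetweenSquares : Prime p → ∃ λ m → m * m < p × p < suc m * suc m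
  primeBetweenSquares {p} pp with isqrt p
  ... | m , m²≤p , p<[1+m]² with m≤n⇒m<n∨m≡n m²≤p
  ...   | inj₁ m²<p = m , m²<p , p<[1+m]²
  ...   | inj₂ m²≡p = ⊥-elim (prime≢square pp m (sym m²≡p))

  3∣m²⇒3∣m : ∀ m → 3 ∣ m * m → 3 ∣ m
  3∣m²⇒3∣m m 3∣m² = [ id , id ]′ (euclidsLemma m m (from-yes (prime? 3)) 3∣m²)

  -- Comparing the two representations: 2p = 2(ac + kbd) + |a - c|² + k|b - d|², and p ∣ ac + kbd forces ac + kbd ≥ p.
  sameRepresentation : ∀ k {a b c d} → 0 < k → 0 < a → 0 < c →
    a * a + k * (b * b) ≡ p → c * c + k * (d * d) ≡ p → p ∣ a * c + k * (b * d) → a ≡ c × b ≡ d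
  sameRepresentation {p} k {a} {b} {c} {d} 0<k 0<a 0<c a²+kb²≡p c²+kd²≡p p∣X =
    ∣m-n∣≡0⇒m≡n (m*m≡0⇒m≡0 _ (m+n≡0⇒m≡0 _ R≡0)) ,
    ∣m-n∣≡0⇒m≡n (m*m≡0⇒m≡0 _ (k*n≡0⇒n≡0 (m+n≡0⇒n≡0 _ R≡0)))
    where
    X R : ℕ
    X = a * c + k * (b * d)
    R = ∣ a - c ∣ * ∣ a - c ∣ + k * (∣ b - d ∣ * ∣ b - d ∣)
    R+2X≡2p : R + (X + X) ≡ p + p
    R+2X≡2p = begin
      R + (X + X)
        ≡⟨ regroup (∣ a - c ∣ * ∣ a - c ∣) (∣ b - d ∣ * ∣ b - d ∣) (a * c) (b * d) k ⟩
      (∣ a - c ∣ * ∣ a - c ∣ + 2 * (a * c)) + k * (∣ b - d ∣ * ∣ b - d ∣ + 2 * (b * d))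
        ≡⟨ cong₂ (λ x y → x + k * y) (∣m-n∣²+2mn≡m²+n² a c) (∣m-n∣²+2mn≡m²+n² b d) ⟩
      (a * a + c * c) + k * (b * b + d * d)
        ≡⟨ regroup′ (a * a) (c * c) (b * b) (d * d) k ⟩
      (a * a + k * (b * b)) + (c * c + k * (d * d))
        ≡⟨ cong₂ _+_ a²+kb²≡p c²+kd²≡p ⟩
      p + p ∎
      where
      open ≡-Reasoning
      regroup : ∀ u v x y k → u + k * v + ((x + k * y) + (x + k * y)) ≡ (u + 2 * x) + k * (v + 2 * y)
      regroup = ℕ-Solver.solve-∀
      regroup′ : ∀ a c b d k → (a + c) + k * (b + d) ≡ (a + k * b) + (c + k * d)
      regroup′ = ℕ-Solver.solve-∀
    p≤X : p ≤ X
    p≤X = ∣⇒≤ {{ℕ.>-nonZero (<-≤-trans (*-mono-< 0<a 0<c) (m≤m+n (a * c) _))}} p∣X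
    R≡0 : R ≡ 0
    R≡0 = n≤0⇒n≡0 (+-cancelʳ-≤ (X + X) R 0 (subst (_≤ X + X) (sym R+2X≡2p) (+-mono-≤ p≤X p≤X)))
    k*n≡0⇒n≡0 : ∀ {n} → k * n ≡ 0 → n ≡ 0
    k*n≡0⇒n≡0 {n} eq with m*n≡0⇒m≡0∨n≡0 k eq
    ... | inj₁ k≡0 = ⊥-elim (<⇒≢ 0<k (sym k≡0))
    ... | inj₂ n≡0 = n≡0

  representation⇒0<b : Prime p → ∀ k a b → a * a + k * (b * b) ≡ p → 0 < b
  representation⇒0<b pp k a zero eq =
    ⊥-elim (prime≢square pp a (sym (trans (sym (+-identityʳ (a * a))) (trans (cong (λ x → a * a + x) (sym (*-zeroʳ k))) eq))))
  representation⇒0<b pp k a (suc b) eq = s≤s z≤n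

  representation⇒0<a : Prime p → 3 < p → ∀ a b → a * a + 3 * (b * b) ≡ p → 0 < a
  representation⇒0<a pp 3<p zero b eq with prime⇒irreducible pp (divides (b * b) (trans (sym eq) (*-comm 3 (b * b))))
  ... | inj₂ 3≡p = ⊥-elim (<⇒≢ 3<p 3≡p)
  representation⇒0<a pp 3<p (suc a) b eq = s≤s z≤n

  p∣[ac+kbd][ad+bc] : ∀ k {a b c d} → a * a + k * (b * b) ≡ p → c * c + k * (d * d) ≡ p →
    p ∣ (a * c + k * (b * d)) * (a * d + b * c)
  p∣[ac+kbd][ad+bc] {p} k {a} {b} {c} {d} a²+kb²≡p c²+kd²≡p = divides (c * d + a * b) (begin
    (a * c + k * (b * d)) * (a * d + b * c)                   ≡⟨ identity a b c d k ⟩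
    (a * a + k * (b * b)) * (c * d) + (c * c + k * (d * d)) * (a * b) ≡⟨ cong₂ (λ x y → x * (c * d) + y * (a * b)) a²+kb²≡p c²+kd²≡p ⟩
    p * (c * d) + p * (a * b)                                 ≡⟨ *-distribˡ-+ p (c * d) (a * b) ⟨
    p * (c * d + a * b)                                       ≡⟨ *-comm p _ ⟩
    (c * d + a * b) * p                                       ∎)
    where
    open ≡-Reasoning
    identity : ∀ a b c d k → (a * c + k * (b * d)) * (a * d + b * c) ≡ (a * a + k * (b * b)) * (c * d) + (c * c + k * (d * d)) * (a * b)
    identity = ℕ-Solver.solve-∀

  sumOfTwoSquares-unique : Prime p → ∀ a b c d → a * a + b * b ≡ p → c * c + d * d ≡ p → c ≡ a ⊎ c ≡ b
  sumOfTwoSquares-unique {p} pp a b c d a²+b²≡p c²+d²≡p =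
    [ (λ p∣ac+bd → inj₁ (sym (proj₁ (sameRepresentation 1 {a} {b} {c} {d} (s≤s z≤n)
                                       (positive a b b²+a²≡p) (positive c d d²+c²≡p) a²+1b²≡p c²+1d²≡p p∣ac+bd))))
    , (λ p∣ad+bc → inj₂ (sym (proj₂ (sameRepresentation 1 {a} {b} {d} {c} (s≤s z≤n)
                                       (positive a b b²+a²≡p) (positive d c c²+d²≡p) a²+1b²≡p d²+1c²≡p
                                       (subst (λ z → p ∣ a * d + z) (sym (*-identityˡ (b * c))) p∣ad+bc)))))
    ]′ (euclidsLemma (a * c + 1 * (b * d)) (a * d + b * c) pp (p∣[ac+kbd][ad+bc] 1 {a} {b} {c} {d} a²+1b²≡p c²+1d²≡p))
    where
    positive : ∀ x y → y * y + x * x ≡ p → 0 < x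
    positive x y eq = representation⇒0<b pp 1 y x (a²+b²≡n⇒a²+1b²≡n y x eq)
    a²+1b²≡p : a * a + 1 * (b * b) ≡ p
    a²+1b²≡p = a²+b²≡n⇒a²+1b²≡n a b a²+b²≡p
    c²+1d²≡p : c * c + 1 * (d * d) ≡ p
    c²+1d²≡p = a²+b²≡n⇒a²+1b²≡n c d c²+d²≡p
    d²+c²≡p : d * d + c * c ≡ p
    d²+c²≡p = trans (+-comm (d * d) (c * c)) c²+d²≡p
    d²+1c²≡p : d * d + 1 * (c * c) ≡ p
    d²+1c²≡p = a²+b²≡n⇒a²+1b²≡n d c d²+c²≡p
    b²+a²≡p : b * b + a * a ≡ p
    b²+a²≡p = trans (+-comm (b * b) (a * a)) a²+b²≡p

  -- The second factor cannot be divisible by p, because p² = |ac - 3bd|² + 3(ad + bc)².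
  sumOfSquareAndThreeSquares-unique : Prime p → 3 < p → ∀ a b c d →
    a * a + 3 * (b * b) ≡ p → c * c + 3 * (d * d) ≡ p → c ≡ a
  sumOfSquareAndThreeSquares-unique {p} pp 3<p a b c d a²+3b²≡p c²+3d²≡p =
    [ (λ p∣ac+3bd → sym (proj₁ (sameRepresentation 3 {a} {b} {c} {d} (s≤s z≤n) 0<a 0<c a²+3b²≡p c²+3d²≡p p∣ac+3bd)))
    , (λ p∣ad+bc → ⊥-elim (<⇒≱ p²<3p² (3p²≤p² p∣ad+bc)))
    ]′ (euclidsLemma (a * c + 3 * (b * d)) (a * d + b * c) pp (p∣[ac+kbd][ad+bc] 3 {a} {b} {c} {d} a²+3b²≡p c²+3d²≡p))
    where
    0<a : 0 < a
    0<a = representation⇒0<a pp 3<p a b a²+3b²≡p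
    0<c : 0 < c
    0<c = representation⇒0<a pp 3<p c d c²+3d²≡p
    0<d : 0 < d
    0<d = representation⇒0<b pp 3 c d c²+3d²≡p
    Y cross : ℕ
    Y = a * d + b * c
    cross = 2 * ((a * c) * (3 * (b * d)))
    p²≡∣ac-3bd∣²+3Y² : ∣ a * c - 3 * (b * d) ∣ * ∣ a * c - 3 * (b * d) ∣ + 3 * (Y * Y) ≡ p * p
    p²≡∣ac-3bd∣²+3Y² = +-cancelʳ-≡ cross _ _ (begin
      ∣ a * c - 3 * (b * d) ∣ * ∣ a * c - 3 * (b * d) ∣ + 3 * (Y * Y) + cross
        ≡⟨ +-comm-middle (∣ a * c - 3 * (b * d) ∣ * ∣ a * c - 3 * (b * d) ∣) (3 * (Y * Y)) cross ⟩
      (∣ a * c - 3 * (b * d) ∣ * ∣ a * c - 3 * (b * d) ∣ + cross) + 3 * (Y * Y)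
        ≡⟨ cong (_+ 3 * (Y * Y)) (∣m-n∣²+2mn≡m²+n² (a * c) (3 * (b * d))) ⟩
      (a * c) * (a * c) + 3 * (b * d) * (3 * (b * d)) + 3 * (Y * Y)
        ≡⟨ identity a b c d ⟩
      (a * a + 3 * (b * b)) * (c * c + 3 * (d * d)) + cross
        ≡⟨ cong₂ (λ x y → x * y + cross) a²+3b²≡p c²+3d²≡p ⟩
      p * p + cross ∎)
      where
      open ≡-Reasoning
      +-comm-middle : ∀ x y z → x + y + z ≡ x + z + y
      +-comm-middle = ℕ-Solver.solve-∀
      identity : ∀ a b c d → (a * c) * (a * c) + 3 * (b * d) * (3 * (b * d)) + 3 * ((a * d + b * c) * (a * d + b * c))
                           ≡ (a * a + 3 * (b * b)) * (c * c + 3 * (d * d)) + 2 * ((a * c) * (3 * (b * d)))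
      identity = ℕ-Solver.solve-∀
    3p²≤p² : p ∣ Y → 3 * (p * p) ≤ p * p
    3p²≤p² p∣Y = ≤-trans (*-monoʳ-≤ 3 (*-mono-≤ p≤Y p≤Y))
      (subst (3 * (Y * Y) ≤_) p²≡∣ac-3bd∣²+3Y² (m≤n+m (3 * (Y * Y)) (∣ a * c - 3 * (b * d) ∣ * ∣ a * c - 3 * (b * d) ∣)))
      where
      p≤Y : p ≤ Y
      p≤Y = ∣⇒≤ {{ℕ.>-nonZero (<-≤-trans (*-mono-< 0<a 0<d) (m≤m+n (a * d) (b * c)))}} p∣Y
    p²<3p² : p * p < 3 * (p * p)
    p²<3p² = subst (p * p <_) (*-comm (p * p) 3) (m<m*n (p * p) 3 {{m*n≢0 p p {{prime⇒nonZero pp}} {{prime⇒nonZero pp}}}} (s≤s (s≤s z≤n)))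

  [3c]²≡3k⇒k≡3c² : ∀ c k → c * 3 * (c * 3) ≡ 3 * k → k ≡ 3 * (c * c)
  [3c]²≡3k⇒k≡3c² c k eq = *-cancelˡ-≡ k (3 * (c * c)) 3 (trans (sym eq) (identity c))
    where
    identity : ∀ c → c * 3 * (c * 3) ≡ 3 * (3 * (c * c))
    identity = ℕ-Solver.solve-∀

  m²≡3n²⇒m≡0 : ∀ m n → m * m ≡ 3 * (n * n) → m ≡ 0
  m²≡3n²⇒m≡0 = <-rec (λ m → ∀ n → m * m ≡ 3 * (n * n) → m ≡ 0) descent
    where
    descent : ∀ m → (∀ {k} → k < m → ∀ n → k * k ≡ 3 * (n * n) → k ≡ 0) → ∀ n → m * m ≡ 3 * (n * n) → m ≡ 0
    descent m _   zero    m²≡0   = m*m≡0⇒m≡0 m m²≡0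
    descent m rec n@(suc _) m²≡3n² = ⊥-elim (smaller (3∣m²⇒3∣m m (divides (n * n) (trans m²≡3n² (*-comm 3 (n * n))))))
      where
      n<m : n < m
      n<m = ≰⇒> λ m≤n → <⇒≱ (subst (n * n <_) (trans (*-comm (n * n) 3) (sym m²≡3n²)) (m<m*n (n * n) 3 (s≤s (s≤s z≤n))))
                               (*-mono-≤ m≤n m≤n)
      smaller : 3 ∣ m → ⊥
      smaller (divides m′ m≡m′*3)
        with rec n<m m′ ([3c]²≡3k⇒k≡3c² m′ (n * n) (subst (λ m → m * m ≡ 3 * (n * n)) m≡m′*3 m²≡3n²))
      ... | ()

  noCommonFirstSquare : Prime p → ∀ s α β → s * s + α * α ≡ p → s * s + 3 * (β * β) ≡ p → ⊥
  noCommonFirstSquare {p} pp s α β s²+α²≡p s²+3β²≡p = prime≢square pp s (begin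
    p                ≡⟨ s²+α²≡p ⟨
    s * s + α * α    ≡⟨ cong (λ α → s * s + α * α) α≡0 ⟩
    s * s + 0        ≡⟨ +-identityʳ (s * s) ⟩
    s * s            ∎)
    where
    open ≡-Reasoning
    α≡0 : α ≡ 0
    α≡0 = m²≡3n²⇒m≡0 α β (+-cancelˡ-≡ (s * s) (α * α) (3 * (β * β)) (trans s²+α²≡p (sym s²+3β²≡p)))


-- Fermat's little theorem, square roots of -1 and -3, and Thue's lemma
module _ where

  open import Data.Nat as ℕ using (ℕ; zero; suc; _!; z≤n; s≤s; NonZero)
  import Data.Nat.Properties as ℕₚ
  import Data.Nat.Divisibility as ℕ
  open import Data.Nat.DivMod using (m/n*n≡m; m%n*o≡m*o%[n*o])
  open import Data.Nat.Combinatorics using (_C_; nCk+nC[k+1]≡[n+1]C[k+1]; nCn≡1; k>n⇒nCk≡0; nCk≡n!/k![n-k]!; k![n∸k]!∣n!)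
  open import Data.Nat.Primality using (Prime; ¬prime[1]; euclidsLemma; prime⇒nonZero)
  import Data.Nat.Tactic.RingSolver as ℕ-Solver
  open import Data.Integer as ℤ using (ℤ; +_; -[1+_]; _+_; _-_; _*_; -_; _^_; 0ℤ; 1ℤ)
  import Data.Integer.Properties as ℤₚ
  open import Data.Integer.DivMod using (_%ℕ_; _/ℕ_; n%ℕd<d; a≡a%ℕn+[a/ℕn]*n)
  open import Data.Integer.Divisibility.Signed
    using (_∣_; _∣?_; divides; ∣ᵤ⇒∣; ∣⇒∣ᵤ; ∣m∣n⇒∣m+n; ∣m∣n⇒∣m-n; ∣m⇒∣m*n; ∣n⇒∣m*n)
  open import Data.Integer.Tactic.RingSolver using (solve-∀)
  open import Data.Fin as Fin using (Fin; toℕ; fromℕ<; remQuot; combine)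
  import Data.Fin.Properties as Finₚ
  open import Data.Product using (∃; ∃₂; _×_; _,_; proj₁; proj₂; uncurry)
  open import Data.Sum using (_⊎_; inj₁; inj₂; [_,_]′)
  open import Data.Empty using (⊥-elim)
  open import Function using (const; id; _∘_)
  open import Relation.Nullary using (¬_)
  open import Relation.Binary.PropositionalEquality

  private
    variable
      p : ℕ

  euclidsLemmaℤ : Prime p → ∀ i j → + p ∣ i * j → + p ∣ i ⊎ + p ∣ j
  euclidsLemmaℤ {p} pp i j p∣ij
    with euclidsLemma ℤ.∣ i ∣ ℤ.∣ j ∣ pp (subst (p ℕ.∣_) (ℤₚ.abs-* i j) (∣⇒∣ᵤ p∣ij))
  ... | inj₁ p∣i = inj₁ (∣ᵤ⇒∣ p∣i)
  ... | inj₂ p∣j = inj₂ (∣ᵤ⇒∣ p∣j)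

  p∣ij∧p∤i⇒p∣j : Prime p → ∀ {i j} → + p ∣ i * j → ¬ + p ∣ i → + p ∣ j
  p∣ij∧p∤i⇒p∣j pp {i} {j} p∣ij p∤i = [ ⊥-elim ∘ p∤i , id ]′ (euclidsLemmaℤ pp i j p∣ij)

  m<p⇒p∤m! : Prime p → ∀ {m} → m ℕ.< p → ¬ p ℕ.∣ m !
  m<p⇒p∤m! pp {zero} _ p∣1 = ℕₚ.<⇒≢ (prime⇒1<p pp) (sym (ℕ.∣1⇒≡1 p∣1))
  m<p⇒p∤m! pp {suc m} m<p p∣m! with euclidsLemma (suc m) (m !) pp p∣m!
  ... | inj₁ p∣m = ℕₚ.<⇒≱ m<p (ℕ.∣⇒≤ p∣m)
  ... | inj₂ p∣m! = m<p⇒p∤m! pp (ℕₚ.<-trans (ℕₚ.n<1+n m) m<p) p∣m!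

  p∣pCk : Prime p → ∀ {k} → 0 ℕ.< k → k ℕ.< p → p ℕ.∣ p C k
  p∣pCk {zero} _ _ ()
  p∣pCk {p@(suc n)} pp {k} 0<k k<p
    with euclidsLemma (p C k) (k ! ℕ.* (p ℕ.∸ k) !) pp (subst (p ℕ.∣_) (sym pCk*k![p∸k]!≡p!) p∣p!)
    where
    p∣p! : p ℕ.∣ p !
    p∣p! = ℕ.m∣m*n (n !)
    pCk*k![p∸k]!≡p! : (p C k) ℕ.* (k ! ℕ.* (p ℕ.∸ k) !) ≡ p !
    pCk*k![p∸k]!≡p! = trans (cong (ℕ._* (k ! ℕ.* (p ℕ.∸ k) !)) (nCk≡n!/k![n-k]! (ℕₚ.<⇒≤ k<p)))
                            (m/n*n≡m {{k ℕₚ.!* p ℕ.∸ k !≢0}} (k![n∸k]!∣n! (ℕₚ.<⇒≤ k<p)))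
  ... | inj₁ p∣pCk = p∣pCk
  ... | inj₂ p∣k![p∸k]! with euclidsLemma (k !) ((p ℕ.∸ k) !) pp p∣k![p∸k]!
  ...   | inj₁ p∣k! = ⊥-elim (m<p⇒p∤m! pp k<p p∣k!)
  ...   | inj₂ p∣[p∸k]! = ⊥-elim (m<p⇒p∤m! pp (ℕₚ.∸-monoʳ-< 0<k (ℕₚ.<⇒≤ k<p)) p∣[p∸k]!)

  binomialSum : ℕ → ℕ → ℤ → ℤ
  binomialSum n zero    x = 0ℤ
  binomialSum n (suc m) x = binomialSum n m x + + (n C m) * x ^ m

  binomialSum-pascal : ∀ n m x →
    binomialSum (suc n) (suc m) x ≡ binomialSum n (suc m) x + x * binomialSum n m x
  binomialSum-pascal n zero x = identity x
    where
    identity : ∀ x → 0ℤ + 1ℤ * 1ℤ ≡ (0ℤ + 1ℤ * 1ℤ) + x * 0ℤ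
    identity = solve-∀
  binomialSum-pascal n (suc m) x = begin
    binomialSum (suc n) (suc m) x + + (suc n C suc m) * x ^ suc m
      ≡⟨ cong₂ (λ s c → s + c * x ^ suc m) (binomialSum-pascal n m x) pascal ⟩
    binomialSum n (suc m) x + x * binomialSum n m x + (+ (n C m) + + (n C suc m)) * (x * x ^ m)
      ≡⟨ identity (binomialSum n (suc m) x) (binomialSum n m x) (+ (n C m)) (+ (n C suc m)) x (x ^ m) ⟩
    binomialSum n (suc m) x + + (n C suc m) * x ^ suc m + x * (binomialSum n m x + + (n C m) * x ^ m) ∎
    where
    open ≡-Reasoning
    pascal : + (suc n C suc m) ≡ + (n C m) + + (n C suc m)
    pascal = trans (cong +_ (sym (nCk+nC[k+1]≡[n+1]C[k+1] n m))) (ℤₚ.pos-+ (n C m) (n C suc m))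
    identity : ∀ A B c c′ x y → A + x * B + (c + c′) * (x * y) ≡ A + c′ * (x * y) + x * (B + c * y)
    identity = solve-∀

  binomialTheorem : ∀ n x → (x + 1ℤ) ^ n ≡ binomialSum n (suc n) x
  binomialTheorem zero    x = refl
  binomialTheorem (suc n) x = begin
    (x + 1ℤ) * (x + 1ℤ) ^ n
      ≡⟨ cong ((x + 1ℤ) *_) (binomialTheorem n x) ⟩
    (x + 1ℤ) * binomialSum n (suc n) x
      ≡⟨ identity x (binomialSum n (suc n) x) (x ^ suc n) ⟩
    binomialSum n (suc n) x + 0ℤ * x ^ suc n + x * binomialSum n (suc n) x
      ≡⟨ cong (λ c → binomialSum n (suc n) x + + c * x ^ suc n + x * binomialSum n (suc n) x) (sym (k>n⇒nCk≡0 (ℕₚ.n<1+n n))) ⟩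
    binomialSum n (suc (suc n)) x + x * binomialSum n (suc n) x
      ≡⟨ binomialSum-pascal n (suc n) x ⟨
    binomialSum (suc n) (suc (suc n)) x ∎
    where
    open ≡-Reasoning
    identity : ∀ x A y → (x + 1ℤ) * A ≡ A + 0ℤ * y + x * A
    identity = solve-∀

  p∣binomialSum-1 : Prime p → ∀ x {m} → m ℕ.< p → + p ∣ binomialSum p (suc m) x - 1ℤ
  p∣binomialSum-1 {p} pp x {zero} _ = subst (+ p ∣_) (identity x) (divides 0ℤ refl)
    where
    identity : ∀ (x : ℤ) → 0ℤ ≡ 0ℤ + 1ℤ * 1ℤ - 1ℤ
    identity = solve-∀
  p∣binomialSum-1 {p} pp x {suc m} m<p =
    subst (+ p ∣_) (identity (binomialSum p (suc m) x) (+ (p C suc m)) (x ^ suc m))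
      (∣m∣n⇒∣m+n (p∣binomialSum-1 pp x (ℕₚ.<-trans (ℕₚ.n<1+n m) m<p))
                 (∣m⇒∣m*n (x ^ suc m) (∣ᵤ⇒∣ {i = + (p C suc m)} (p∣pCk pp (s≤s z≤n) m<p))))
    where
    identity : ∀ A c y → A - 1ℤ + c * y ≡ A + c * y - 1ℤ
    identity = solve-∀

  frobenius : Prime p → ∀ x → + p ∣ (x + 1ℤ) ^ p - x ^ p - 1ℤ
  frobenius {zero} ()
  frobenius {p@(suc n)} pp x = subst (+ p ∣_) (sym expansion) (p∣binomialSum-1 pp x (ℕₚ.n<1+n n))
    where
    open ≡-Reasoning
    identity : ∀ A y → A + 1ℤ * y - y - 1ℤ ≡ A - 1ℤ
    identity = solve-∀
    expansion : (x + 1ℤ) ^ p - x ^ p - 1ℤ ≡ binomialSum p p x - 1ℤ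
    expansion = begin
      (x + 1ℤ) ^ p - x ^ p - 1ℤ
        ≡⟨ cong (λ y → y - x ^ p - 1ℤ) (binomialTheorem p x) ⟩
      binomialSum p p x + + (p C p) * x ^ p - x ^ p - 1ℤ
        ≡⟨ cong (λ c → binomialSum p p x + + c * x ^ p - x ^ p - 1ℤ) (nCn≡1 p) ⟩
      binomialSum p p x + 1ℤ * x ^ p - x ^ p - 1ℤ
        ≡⟨ identity (binomialSum p p x) (x ^ p) ⟩
      binomialSum p p x - 1ℤ ∎

  p∣xᵖ-x : Prime p → ∀ x → + p ∣ (+ x) ^ p - + x
  p∣xᵖ-x {zero} ()
  p∣xᵖ-x {p@(suc n)} pp zero = subst (+ p ∣_) (sym (ℤₚ.+-inverseʳ (0ℤ ^ p))) (divides 0ℤ refl)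
  p∣xᵖ-x {p} pp (suc x) =
    subst (λ y → + p ∣ y ^ p - y) (sym +[1+x]≡+x+1)
      (subst (+ p ∣_) (identity ((+ x + 1ℤ) ^ p) ((+ x) ^ p) (+ x))
        (∣m∣n⇒∣m+n (frobenius pp (+ x)) (p∣xᵖ-x pp x)))
    where
    +[1+x]≡+x+1 : + suc x ≡ + x + 1ℤ
    +[1+x]≡+x+1 = trans (cong +_ (ℕₚ.+-comm 1 x)) (ℤₚ.pos-+ x 1)
    identity : ∀ A B y → A - B - 1ℤ + (B - y) ≡ A - (y + 1ℤ)
    identity = solve-∀

  fermatsLittleTheorem : Prime p → ∀ {x} → 0 ℕ.< x → x ℕ.< p → + p ∣ (+ x) ^ (p ℕ.∸ 1) - 1ℤ
  fermatsLittleTheorem {zero} ()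
  fermatsLittleTheorem {p@(suc n)} pp {x} 0<x x<p =
    p∣ij∧p∤i⇒p∣j pp {+ x} (subst (+ p ∣_) (identity (+ x) ((+ x) ^ n)) (p∣xᵖ-x pp x))
      λ p∣x → ℕₚ.<⇒≱ x<p (ℕ.∣⇒≤ {{ℕ.>-nonZero 0<x}} (∣⇒∣ᵤ p∣x))
    where
    identity : ∀ x y → x * y - x ≡ x * (y - 1ℤ)
    identity = solve-∀

  Δ : ℕ → (ℤ → ℤ) → ℤ → ℤ
  Δ zero    f x = f x
  Δ (suc k) f x = Δ k f (x + 1ℤ) - Δ k f x

  Δ-leibniz : ∀ k g x →
    Δ (suc k) (λ y → y * g y) x ≡ x * Δ (suc k) g x + + suc k * Δ k g (x + 1ℤ)
  Δ-leibniz zero g x = identity x (g (x + 1ℤ)) (g x)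
    where
    identity : ∀ x a b → (x + 1ℤ) * a - x * b ≡ x * (a - b) + 1ℤ * a
    identity = solve-∀
  Δ-leibniz (suc k) g x
    rewrite Δ-leibniz k g (x + 1ℤ) | Δ-leibniz k g x | ℤₚ.pos-+ 1 (suc k) =
    identity x (Δ (suc k) g x) (Δ k g (x + 1ℤ + 1ℤ)) (Δ k g (x + 1ℤ)) (+ suc k)
    where
    identity : ∀ x a b c n →
      (x + 1ℤ) * (b - c) + n * b - (x * a + n * c) ≡ x * (b - c - a) + (1ℤ + n) * (b - c)
    identity = solve-∀

  Δ-pow : ∀ m x → Δ m (_^ m) x ≡ + (m !)
  Δ-pow zero    x = refl
  Δ-pow (suc m) x
    rewrite Δ-leibniz m (_^ m) x | Δ-pow m (x + 1ℤ) | Δ-pow m x =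
    trans (identity x (+ (m !)) (+ suc m)) (sym (ℤₚ.pos-* (suc m) (m !)))
    where
    identity : ∀ x a n → x * (a - a) + n * a ≡ n * a
    identity = solve-∀

  Δ-const : ∀ k c x → Δ (suc k) (const c) x ≡ 0ℤ
  Δ-const zero    c x = ℤₚ.+-inverseʳ c
  Δ-const (suc k) c x rewrite Δ-const k c (x + 1ℤ) | Δ-const k c x = refl

  Δ-sub : ∀ k f g x → Δ k (λ y → f y - g y) x ≡ Δ k f x - Δ k g x
  Δ-sub zero    f g x = refl
  Δ-sub (suc k) f g x rewrite Δ-sub k f g (x + 1ℤ) | Δ-sub k f g x =
    identity (Δ k f (x + 1ℤ)) (Δ k g (x + 1ℤ)) (Δ k f x) (Δ k g x)
    where
    identity : ∀ a b c d → a - b - (c - d) ≡ a - c - (b - d)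
    identity = solve-∀

  Δ-divisible : ∀ {d} k f x → (∀ i → i ℕ.≤ k → d ∣ f (x + + i)) → d ∣ Δ k f x
  Δ-divisible zero f x d∣f = subst (λ y → _ ∣ f y) (ℤₚ.+-identityʳ x) (d∣f 0 z≤n)
  Δ-divisible (suc k) f x d∣f = ∣m∣n⇒∣m-n
    (Δ-divisible k f (x + 1ℤ) λ i i≤k → subst (λ y → _ ∣ f y) (x+[1+i]≡x+1+i i) (d∣f (suc i) (s≤s i≤k)))
    (Δ-divisible k f x λ i i≤k → d∣f i (ℕₚ.m≤n⇒m≤1+n i≤k))
    where
    x+[1+i]≡x+1+i : ∀ i → x + + suc i ≡ x + 1ℤ + + i
    x+[1+i]≡x+1+i i = trans (cong (λ j → x + j) (ℤₚ.pos-+ 1 i)) (sym (ℤₚ.+-assoc x 1ℤ (+ i)))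

  rootBound : Prime p → ∀ m → 0 ℕ.< m → m ℕ.< p →
    ¬ (∀ (i : Fin (suc m)) → + p ∣ (+ suc (toℕ i)) ^ m - 1ℤ)
  rootBound {p} pp (suc k) _ m<p allRoots = m<p⇒p∤m! pp m<p (∣⇒∣ᵤ p∣m!)
    where
    m : ℕ
    m = suc k
    f : ℤ → ℤ
    f y = y ^ m - 1ℤ
    p∣Δf : + p ∣ Δ m f 1ℤ
    p∣Δf = Δ-divisible m f 1ℤ λ i i≤m →
      subst (λ j → + p ∣ (+ suc j) ^ m - 1ℤ) (Finₚ.toℕ-fromℕ< (s≤s i≤m)) (allRoots (Fin.fromℕ< (s≤s i≤m)))
    Δf≡m! : Δ m f 1ℤ ≡ + (m !)
    Δf≡m! = begin
      Δ m f 1ℤ                         ≡⟨ Δ-sub m (_^ m) (const 1ℤ) 1ℤ ⟩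
      Δ m (_^ m) 1ℤ - Δ m (const 1ℤ) 1ℤ ≡⟨ cong₂ _-_ (Δ-pow m 1ℤ) (Δ-const k 1ℤ 1ℤ) ⟩
      + (m !) - 0ℤ                     ≡⟨ ℤₚ.+-identityʳ (+ (m !)) ⟩
      + (m !)                          ∎
      where open ≡-Reasoning
    p∣m! : + p ∣ + (m !)
    p∣m! = subst (+ p ∣_) Δf≡m! p∣Δf

  nonRoot : Prime p → ∀ {m} → 0 ℕ.< m → suc m ℕ.< p →
    ∃ λ x → 0 ℕ.< x × x ℕ.< p × ¬ + p ∣ (+ x) ^ m - 1ℤ
  nonRoot {p} pp {m} 0<m 1+m<p
    with Finₚ.¬∀⟶∃¬ (suc m) (λ i → + p ∣ (+ suc (toℕ i)) ^ m - 1ℤ) (λ i → + p ∣? _)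
           (rootBound pp m 0<m (ℕₚ.<-trans (ℕₚ.n<1+n m) 1+m<p))
  ... | i , nonroot = suc (toℕ i) , s≤s z≤n , ℕₚ.≤-<-trans (s≤s (Finₚ.toℕ≤pred[n] i)) 1+m<p , nonroot

  i^[2n]≡i^n*i^n : ∀ i n → i ^ (2 ℕ.* n) ≡ i ^ n * i ^ n
  i^[2n]≡i^n*i^n i n = trans (cong (λ m → i ^ (n ℕ.+ m)) (ℕₚ.+-identityʳ n)) (ℤₚ.^-distribˡ-+-* i n n)

  minusOneIsSquareMod : Prime p → ∀ {t} → p ≡ 1 ℕ.+ 4 ℕ.* t → 0 ℕ.< t → ∃ λ y → + p ∣ y * y + 1ℤ
  minusOneIsSquareMod {p} pp {t} refl 0<t =
    fromNonRoot (nonRoot pp (ℕₚ.*-monoʳ-< 2 0<t) (s≤s (ℕₚ.*-monoˡ-< t {{ℕ.>-nonZero 0<t}} {2} {4} (s≤s (s≤s (s≤s z≤n))))))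
    where
    fromNonRoot : (∃ λ x → 0 ℕ.< x × x ℕ.< p × ¬ + p ∣ (+ x) ^ (2 ℕ.* t) - 1ℤ) → ∃ λ y → + p ∣ y * y + 1ℤ
    fromNonRoot (x , 0<x , x<p , p∤x²ᵗ-1) =
      y , p∣ij∧p∤i⇒p∣j pp (subst (+ p ∣_) x⁴ᵗ-1≡[y²-1][y²+1] (fermatsLittleTheorem pp 0<x x<p))
            (p∤x²ᵗ-1 ∘ subst (λ z → + p ∣ z - 1ℤ) (sym x²ᵗ≡y²))
      where
      y : ℤ
      y = (+ x) ^ t
      x²ᵗ≡y² : (+ x) ^ (2 ℕ.* t) ≡ y * y
      x²ᵗ≡y² = i^[2n]≡i^n*i^n (+ x) t
      identity : ∀ z → z * z - 1ℤ ≡ (z - 1ℤ) * (z + 1ℤ)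
      identity = solve-∀
      x⁴ᵗ-1≡[y²-1][y²+1] : (+ x) ^ (4 ℕ.* t) - 1ℤ ≡ (y * y - 1ℤ) * (y * y + 1ℤ)
      x⁴ᵗ-1≡[y²-1][y²+1] = begin
        (+ x) ^ (4 ℕ.* t) - 1ℤ                          ≡⟨ cong (λ n → (+ x) ^ n - 1ℤ) (ℕₚ.*-distribʳ-+ t 2 2) ⟩
        (+ x) ^ (2 ℕ.* t ℕ.+ 2 ℕ.* t) - 1ℤ             ≡⟨ cong (_- 1ℤ) (ℤₚ.^-distribˡ-+-* (+ x) (2 ℕ.* t) (2 ℕ.* t)) ⟩
        (+ x) ^ (2 ℕ.* t) * (+ x) ^ (2 ℕ.* t) - 1ℤ     ≡⟨ identity ((+ x) ^ (2 ℕ.* t)) ⟩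
        ((+ x) ^ (2 ℕ.* t) - 1ℤ) * ((+ x) ^ (2 ℕ.* t) + 1ℤ) ≡⟨ cong (λ z → (z - 1ℤ) * (z + 1ℤ)) x²ᵗ≡y² ⟩
        (y * y - 1ℤ) * (y * y + 1ℤ)                     ∎
        where open ≡-Reasoning

  minusThreeIsSquareMod : Prime p → ∀ {t} → p ≡ 1 ℕ.+ 3 ℕ.* t → 0 ℕ.< t → ∃ λ y → + p ∣ y * y + + 3
  minusThreeIsSquareMod {p} pp {t} refl 0<t =
    fromNonRoot (nonRoot pp 0<t (s≤s (ℕₚ.m<m+n t (ℕₚ.*-monoʳ-< 2 0<t))))
    where
    fromNonRoot : (∃ λ x → 0 ℕ.< x × x ℕ.< p × ¬ + p ∣ (+ x) ^ t - 1ℤ) → ∃ λ y → + p ∣ y * y + + 3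
    fromNonRoot (x , 0<x , x<p , p∤xᵗ-1) =
      + 2 * z + 1ℤ , subst (+ p ∣_) (identity₂ z) (∣n⇒∣m*n (+ 4) p∣z²+z+1)
      where
      z : ℤ
      z = (+ x) ^ t
      identity : ∀ z → z * (z * z) - 1ℤ ≡ (z - 1ℤ) * (z * z + z + 1ℤ)
      identity = solve-∀
      identity₂ : ∀ z → + 4 * (z * z + z + 1ℤ) ≡ (+ 2 * z + 1ℤ) * (+ 2 * z + 1ℤ) + + 3
      identity₂ = solve-∀
      x³ᵗ-1≡[z-1][z²+z+1] : (+ x) ^ (3 ℕ.* t) - 1ℤ ≡ (z - 1ℤ) * (z * z + z + 1ℤ)
      x³ᵗ-1≡[z-1][z²+z+1] = begin
        (+ x) ^ (t ℕ.+ 2 ℕ.* t) - 1ℤ        ≡⟨ cong (_- 1ℤ) (ℤₚ.^-distribˡ-+-* (+ x) t (2 ℕ.* t)) ⟩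
        z * (+ x) ^ (2 ℕ.* t) - 1ℤ          ≡⟨ cong (λ w → z * w - 1ℤ) (i^[2n]≡i^n*i^n (+ x) t) ⟩
        z * (z * z) - 1ℤ                    ≡⟨ identity z ⟩
        (z - 1ℤ) * (z * z + z + 1ℤ)         ∎
        where open ≡-Reasoning
      p∣z²+z+1 : + p ∣ z * z + z + 1ℤ
      p∣z²+z+1 = p∣ij∧p∤i⇒p∣j pp (subst (+ p ∣_) x³ᵗ-1≡[z-1][z²+z+1] (fermatsLittleTheorem pp 0<x x<p)) p∤xᵗ-1

  %ℕ-≡⇒∣- : ∀ {a b d} .{{_ : NonZero d}} → a %ℕ d ≡ b %ℕ d → + d ∣ a - b
  %ℕ-≡⇒∣- {a} {b} {d} a%d≡b%d = divides (a /ℕ d - b /ℕ d) (begin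
    a - b
      ≡⟨ cong₂ _-_ (a≡a%ℕn+[a/ℕn]*n a d) (a≡a%ℕn+[a/ℕn]*n b d) ⟩
    (+ (a %ℕ d) + a /ℕ d * + d) - (+ (b %ℕ d) + b /ℕ d * + d)
      ≡⟨ cong (λ r → (+ (a %ℕ d) + a /ℕ d * + d) - (+ r + b /ℕ d * + d)) (sym a%d≡b%d) ⟩
    (+ (a %ℕ d) + a /ℕ d * + d) - (+ (a %ℕ d) + b /ℕ d * + d)
      ≡⟨ identity (+ (a %ℕ d)) (a /ℕ d) (b /ℕ d) (+ d) ⟩
    (a /ℕ d - b /ℕ d) * + d ∎)
    where
    open ≡-Reasoning
    identity : ∀ r x y d → (r + x * d) - (r + y * d) ≡ (x - y) * d
    identity = solve-∀

  -- Pigeonhole on the (m + 1)² values i + y j mod p, for 0 ≤ i, j ≤ m.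
  thuesLemma : ∀ {p} .{{_ : NonZero p}} m → p ℕ.< suc m ℕ.* suc m → ∀ y →
    ∃₂ λ u v → ℤ.∣ u ∣ ℕ.≤ m × ℤ.∣ v ∣ ℕ.≤ m × ¬ (u ≡ 0ℤ × v ≡ 0ℤ) × + p ∣ u + y * v
  thuesLemma {p} m p<n² y = fromCollision (Finₚ.pigeonhole p<n² residue)
    where
    n : ℕ
    n = suc m
    row col : Fin (n ℕ.* n) → Fin n
    row k = proj₁ (remQuot {n} n k)
    col k = proj₂ (remQuot {n} n k)
    value : Fin (n ℕ.* n) → ℤ
    value k = + toℕ (row k) + y * + toℕ (col k)
    residue : Fin (n ℕ.* n) → Fin p
    residue k = fromℕ< (n%ℕd<d (value k) p)
    ∣-∣≤m : ∀ (a b : Fin n) → ℤ.∣ + toℕ a - + toℕ b ∣ ℕ.≤ m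
    ∣-∣≤m a b = subst (ℕ._≤ m) (cong ℤ.∣_∣ (sym (ℤₚ.m-n≡m⊖n (toℕ a) (toℕ b))))
      (ℕₚ.≤-trans (ℤₚ.∣m⊝n∣≤m⊔n (toℕ a) (toℕ b)) (ℕₚ.⊔-lub (Finₚ.toℕ≤pred[n] a) (Finₚ.toℕ≤pred[n] b)))
    fin-≡ : ∀ {a b : Fin n} → + toℕ a - + toℕ b ≡ 0ℤ → a ≡ b
    fin-≡ {a} {b} eq = Finₚ.toℕ-injective (ℤₚ.+-injective (ℤₚ.i-j≡0⇒i≡j (+ toℕ a) (+ toℕ b) eq))
    fromCollision : (∃₂ λ k₁ k₂ → k₁ Fin.< k₂ × residue k₁ ≡ residue k₂) →
      ∃₂ λ u v → ℤ.∣ u ∣ ℕ.≤ m × ℤ.∣ v ∣ ℕ.≤ m × ¬ (u ≡ 0ℤ × v ≡ 0ℤ) × + p ∣ u + y * v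
    fromCollision (k₁ , k₂ , k₁<k₂ , same) =
      + toℕ (row k₁) - + toℕ (row k₂) , + toℕ (col k₁) - + toℕ (col k₂) ,
      ∣-∣≤m (row k₁) (row k₂) , ∣-∣≤m (col k₁) (col k₂) , distinct ,
      subst (+ p ∣_) (identity (+ toℕ (row k₁)) (+ toℕ (row k₂)) (+ toℕ (col k₁)) (+ toℕ (col k₂)) y) p∣value-value
      where
      identity : ∀ a b c d y → (a + y * c) - (b + y * d) ≡ (a - b) + y * (c - d)
      identity = solve-∀
      p∣value-value : + p ∣ value k₁ - value k₂
      p∣value-value = %ℕ-≡⇒∣- {value k₁} {value k₂} (trans (sym (Finₚ.toℕ-fromℕ< _)) (trans (cong toℕ same) (Finₚ.toℕ-fromℕ< _)))
      distinct : ¬ (+ toℕ (row k₁) - + toℕ (row k₂) ≡ 0ℤ × + toℕ (col k₁) - + toℕ (col k₂) ≡ 0ℤ)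
      distinct (u≡0 , v≡0) = ℕₚ.<-irrefl (cong toℕ k₁≡k₂) k₁<k₂
        where
        k₁≡k₂ : k₁ ≡ k₂
        k₁≡k₂ = begin
          k₁                              ≡⟨ Finₚ.combine-remQuot {n} n k₁ ⟨
          combine {n} {n} (row k₁) (col k₁) ≡⟨ cong₂ combine (fin-≡ {row k₁} {row k₂} u≡0) (fin-≡ {col k₁} {col k₂} v≡0) ⟩
          combine {n} {n} (row k₂) (col k₂) ≡⟨ Finₚ.combine-remQuot {n} n k₂ ⟩
          k₂                              ∎
          where open ≡-Reasoning

  i*i≡+∣i∣*∣i∣ : ∀ i → i * i ≡ + (ℤ.∣ i ∣ ℕ.* ℤ.∣ i ∣)
  i*i≡+∣i∣*∣i∣ (+ n) = sym (ℤₚ.pos-* n n)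
  i*i≡+∣i∣*∣i∣ -[1+ n ] = trans (identity (+ suc n)) (sym (ℤₚ.pos-* (suc n) (suc n)))
    where
    identity : ∀ i → (- i) * (- i) ≡ i * i
    identity = solve-∀

  pos-∣u∣²+d∣v∣² : ∀ u d v → + (ℤ.∣ u ∣ ℕ.* ℤ.∣ u ∣ ℕ.+ d ℕ.* (ℤ.∣ v ∣ ℕ.* ℤ.∣ v ∣)) ≡ u * u + + d * (v * v)
  pos-∣u∣²+d∣v∣² u d v = trans (ℤₚ.pos-+ _ (d ℕ.* _)) (cong₂ _+_ (sym (i*i≡+∣i∣*∣i∣ u))
    (trans (ℤₚ.pos-* d _) (cong (+ d *_) (sym (i*i≡+∣i∣*∣i∣ v)))))

  thueRepresentation : Prime p → ∀ d → 0 ℕ.< d → ∀ y → + p ∣ y * y + + d →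
    ∃₂ λ a b → ∃ λ q → a ℕ.* a ℕ.+ d ℕ.* (b ℕ.* b) ≡ q ℕ.* p × 0 ℕ.< q × q ℕ.≤ d
  thueRepresentation {p} pp d 0<d y p∣y²+d with primeBetweenSquares pp
  ... | m , m²<p , p<[1+m]² = fromThue (thuesLemma {{prime⇒nonZero pp}} m p<[1+m]² y)
    where
    fromThue : (∃₂ λ u v → ℤ.∣ u ∣ ℕ.≤ m × ℤ.∣ v ∣ ℕ.≤ m × ¬ (u ≡ 0ℤ × v ≡ 0ℤ) × + p ∣ u + y * v) →
      ∃₂ λ a b → ∃ λ q → a ℕ.* a ℕ.+ d ℕ.* (b ℕ.* b) ≡ q ℕ.* p × 0 ℕ.< q × q ℕ.≤ d
    fromThue (u , v , ∣u∣≤m , ∣v∣≤m , uv≢0 , p∣u+yv) = ℤ.∣ u ∣ , ℤ.∣ v ∣ , boundedMultiple d p∣N 0<N N<[1+d]p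
      where
      N : ℕ
      N = ℤ.∣ u ∣ ℕ.* ℤ.∣ u ∣ ℕ.+ d ℕ.* (ℤ.∣ v ∣ ℕ.* ℤ.∣ v ∣)
      identity : ∀ u v y d → (u + y * v) * (u - y * v) + v * v * (y * y + d) ≡ u * u + d * (v * v)
      identity = solve-∀
      p∣N : p ℕ.∣ N
      p∣N = ∣⇒∣ᵤ (subst (+ p ∣_) (trans (identity u v y (+ d)) (sym (pos-∣u∣²+d∣v∣² u d v)))
        (∣m∣n⇒∣m+n (∣m⇒∣m*n (u - y * v) p∣u+yv) (∣n⇒∣m*n (v * v) p∣y²+d)))
      N<[1+d]p : N ℕ.< suc d ℕ.* p
      N<[1+d]p = ℕₚ.+-mono-<-≤ (ℕₚ.≤-<-trans (ℕₚ.*-mono-≤ ∣u∣≤m ∣u∣≤m) m²<p)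
                                (ℕₚ.*-monoʳ-≤ d (ℕₚ.<⇒≤ (ℕₚ.≤-<-trans (ℕₚ.*-mono-≤ ∣v∣≤m ∣v∣≤m) m²<p)))
      0<N : 0 ℕ.< N
      0<N = ℕₚ.n≢0⇒n>0 λ N≡0 → uv≢0 (u≡0 N≡0 , v≡0 N≡0)
        where
        square≡0 : ∀ i → ℤ.∣ i ∣ ℕ.* ℤ.∣ i ∣ ≡ 0 → i ≡ 0ℤ
        square≡0 i eq = ℤₚ.∣i∣≡0⇒i≡0 (m*m≡0⇒m≡0 ℤ.∣ i ∣ eq)
        u≡0 : N ≡ 0 → u ≡ 0ℤ
        u≡0 eq = square≡0 u (ℕₚ.m+n≡0⇒m≡0 (ℤ.∣ u ∣ ℕ.* ℤ.∣ u ∣) eq)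
        v≡0 : N ≡ 0 → v ≡ 0ℤ
        v≡0 eq with ℕₚ.m*n≡0⇒m≡0∨n≡0 d (ℕₚ.m+n≡0⇒n≡0 (ℤ.∣ u ∣ ℕ.* ℤ.∣ u ∣) eq)
        ... | inj₁ d≡0 = ⊥-elim (ℕₚ.<⇒≢ 0<d (sym d≡0))
        ... | inj₂ b²≡0 = square≡0 v b²≡0

  sumOfTwoSquares : Prime p → p ℕ.% 4 ≡ 1 → ∃₂ λ a b → a ℕ.* a ℕ.+ b ℕ.* b ≡ p
  sumOfTwoSquares {p} pp p%4≡1 = fromMultiple (thueRepresentation pp 1 (s≤s z≤n) (proj₁ root) (proj₂ root))
    where
    root : ∃ λ y → + p ∣ y * y + 1ℤ
    root = uncurry (minusOneIsSquareMod pp {p ℕ./ 4}) (prime%d≡1⇒p≡1+dt pp 4 p%4≡1)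
    fromMultiple : (∃₂ λ a b → ∃ λ q → a ℕ.* a ℕ.+ 1 ℕ.* (b ℕ.* b) ≡ q ℕ.* p × 0 ℕ.< q × q ℕ.≤ 1) →
      ∃₂ λ a b → a ℕ.* a ℕ.+ b ℕ.* b ≡ p
    fromMultiple (a , b , .1 , a²+1b²≡1p , s≤s z≤n , s≤s z≤n) =
      a , b , trans (cong (a ℕ.* a ℕ.+_) (sym (ℕₚ.*-identityˡ (b ℕ.* b)))) (trans a²+1b²≡1p (ℕₚ.*-identityˡ p))

  sumOfSquareAndThreeSquares : Prime p → 3 ℕ.< p → p ℕ.% 3 ≡ 1 → ∃₂ λ a b → a ℕ.* a ℕ.+ 3 ℕ.* (b ℕ.* b) ≡ p
  sumOfSquareAndThreeSquares {p} pp 3<p p%3≡1 = fromMultiple (thueRepresentation pp 3 (s≤s z≤n) (proj₁ root) (proj₂ root))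
    where
    root : ∃ λ y → + p ∣ y * y + + 3
    root = uncurry (minusThreeIsSquareMod pp {p ℕ./ 3}) (prime%d≡1⇒p≡1+dt pp 3 p%3≡1)
    reduce : ∀ a b q → a ℕ.* a ℕ.+ 3 ℕ.* (b ℕ.* b) ≡ q ℕ.* p → 0 ℕ.< q → q ℕ.≤ 3 →
      ∃₂ λ a b → a ℕ.* a ℕ.+ 3 ℕ.* (b ℕ.* b) ≡ p
    reduce a b 1 a²+3b²≡p _ _ = a , b , trans a²+3b²≡p (ℕₚ.*-identityˡ p)
    reduce a b 2 a²+3b²≡2p _ _ = ⊥-elim (a²+3b²%4≢2 a b (begin
      (a ℕ.* a ℕ.+ 3 ℕ.* (b ℕ.* b)) ℕ.% 4 ≡⟨ cong (ℕ._% 4) (trans a²+3b²≡2p (ℕₚ.*-comm 2 p)) ⟩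
      p ℕ.* 2 ℕ.% 4                         ≡⟨ m%n*o≡m*o%[n*o] p 2 2 ⟨
      p ℕ.% 2 ℕ.* 2                         ≡⟨ cong (ℕ._* 2) (prime>2⇒odd pp (ℕₚ.<-trans (ℕₚ.n<1+n 2) 3<p)) ⟩
      2                                     ∎))
      where open ≡-Reasoning
    reduce a b 3 a²+3b²≡3p _ _ = fromThird (3∣m²⇒3∣m a 3∣a²)
      where
      3∣a² : 3 ℕ.∣ a ℕ.* a
      3∣a² = ℕ.∣m+n∣m⇒∣n (subst (3 ℕ.∣_) (sym (trans (ℕₚ.+-comm (3 ℕ.* (b ℕ.* b)) (a ℕ.* a)) a²+3b²≡3p)) (ℕ.m∣m*n p))
                          (ℕ.m∣m*n (b ℕ.* b))
      identity : ∀ b a′ → 3 ℕ.* (b ℕ.* b ℕ.+ 3 ℕ.* (a′ ℕ.* a′)) ≡ a′ ℕ.* 3 ℕ.* (a′ ℕ.* 3) ℕ.+ 3 ℕ.* (b ℕ.* b)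
      identity = ℕ-Solver.solve-∀
      fromThird : 3 ℕ.∣ a → ∃₂ λ a b → a ℕ.* a ℕ.+ 3 ℕ.* (b ℕ.* b) ≡ p
      fromThird (ℕ.divides a′ a≡a′*3) = b , a′ , ℕₚ.*-cancelˡ-≡ (b ℕ.* b ℕ.+ 3 ℕ.* (a′ ℕ.* a′)) p 3 (begin
        3 ℕ.* (b ℕ.* b ℕ.+ 3 ℕ.* (a′ ℕ.* a′))         ≡⟨ identity b a′ ⟩
        a′ ℕ.* 3 ℕ.* (a′ ℕ.* 3) ℕ.+ 3 ℕ.* (b ℕ.* b)   ≡⟨ cong (λ a → a ℕ.* a ℕ.+ 3 ℕ.* (b ℕ.* b)) a≡a′*3 ⟨
        a ℕ.* a ℕ.+ 3 ℕ.* (b ℕ.* b)                   ≡⟨ a²+3b²≡3p ⟩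
        3 ℕ.* p                                        ∎)
        where open ≡-Reasoning
    reduce a b (suc (suc (suc (suc _)))) _ _ (s≤s (s≤s (s≤s ())))
    fromMultiple : (∃₂ λ a b → ∃ λ q → a ℕ.* a ℕ.+ 3 ℕ.* (b ℕ.* b) ≡ q ℕ.* p × 0 ℕ.< q × q ℕ.≤ 3) →
      ∃₂ λ a b → a ℕ.* a ℕ.+ 3 ℕ.* (b ℕ.* b) ≡ p
    fromMultiple (a , b , q , a²+3b²≡qp , 0<q , q≤3) = reduce a b q a²+3b²≡qp 0<q q≤3


-- Counting and summing over lists
module _ where

  open import Algebra.Bundles using (CommutativeMonoid)
  open import Data.Bool using (Bool; true; false; T; if_then_else_; _∧_; _∨_)
  open import Data.Bool.Properties using (∨-identityʳ; ∧-zeroʳ; T-∧)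
  open import Data.Nat as ℕ using (ℕ; zero; suc; s≤s; _≡ᵇ_)
  import Data.Nat.Properties as ℕₚ
  import Data.Nat.Tactic.RingSolver as ℕ-Solver
  open import Data.Integer as ℤ using (ℤ; +_; -[1+_]; _-_)
  import Data.Integer.Properties as ℤₚ
  open import Data.Integer.Tactic.RingSolver using (solve-∀)
  open import Data.List using (List; []; _∷_; map; filter; upTo)
  import Data.List.Properties as Listₚ
  open import Data.Rational as ℚ using (ℚ; 0ℚ)
  import Data.Rational.Properties as ℚₚ
  open import Algebra.Definitions.RawMonoid ℚ.+-0-rawMonoid using () renaming (_×_ to _·_)
  open import Algebra.Properties.CommutativeSemigroup (CommutativeMonoid.commutativeSemigroup ℚₚ.+-0-commutativeMonoid) using (interchange)
  open import Data.Product using (∃; _×_; _,_; proj₁; proj₂)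
  open import Data.Empty using (⊥-elim)
  open import Function using (_∘_)
  open import Function.Bundles using (Equivalence)
  open import Relation.Nullary using (¬_; Dec; yes; no; does)
  open import Relation.Unary using (Decidable)
  open import Relation.Binary.PropositionalEquality

  private
    variable
      A B : Set

  T⇔T⇒≡ : ∀ {a b} → (T a → T b) → (T b → T a) → a ≡ b
  T⇔T⇒≡ {false} {false} _ _ = refl
  T⇔T⇒≡ {false} {true}  _ g = ⊥-elim (g _)
  T⇔T⇒≡ {true}  {false} f _ = ⊥-elim (f _)
  T⇔T⇒≡ {true}  {true}  _ _ = refl

  ¬T⇒≡false : ∀ {b} → ¬ T b → b ≡ false
  ¬T⇒≡false {false} _  = refl
  ¬T⇒≡false {true}  ¬t = ⊥-elim (¬t _)


  T-does⇒ : ∀ {P : Set} (P? : Dec P) → T (does P?) → P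
  T-does⇒ (yes p) _ = p

  ⇒T-does : ∀ {P : Set} (P? : Dec P) → P → T (does P?)
  ⇒T-does (yes _) _ = _
  ⇒T-does (no ¬p) p = ¬p p

  count : (A → Bool) → List A → ℕ
  count P []       = 0
  count P (x ∷ xs) = if P x then suc (count P xs) else count P xs

  count-cong : ∀ {P Q : A → Bool} → (∀ x → P x ≡ Q x) → ∀ xs → count P xs ≡ count Q xs
  count-cong P≡Q []       = refl
  count-cong P≡Q (x ∷ xs) rewrite P≡Q x | count-cong P≡Q xs = refl

  count-map : ∀ (P : B → Bool) (f : A → B) xs → count P (map f xs) ≡ count (P ∘ f) xs
  count-map P f []       = refl
  count-map P f (x ∷ xs) rewrite count-map P f xs = refl

  count-false : ∀ {P : A → Bool} → (∀ x → P x ≡ false) → ∀ xs → count P xs ≡ 0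
  count-false P≡false []       = refl
  count-false P≡false (x ∷ xs) rewrite P≡false x = count-false P≡false xs

  count-∨ : ∀ (P Q : A → Bool) xs →
    count (λ x → P x ∨ Q x) xs ℕ.+ count (λ x → P x ∧ Q x) xs ≡ count P xs ℕ.+ count Q xs
  count-∨ P Q []       = refl
  count-∨ P Q (x ∷ xs) with P x | Q x
  ... | true  | true  = cong suc (trans (ℕₚ.+-suc _ _) (trans (cong suc (count-∨ P Q xs)) (sym (ℕₚ.+-suc _ _))))
  ... | true  | false = cong suc (count-∨ P Q xs)
  ... | false | true  = trans (cong suc (count-∨ P Q xs)) (sym (ℕₚ.+-suc _ _))
  ... | false | false = count-∨ P Q xs

  count-∨-disjoint : ∀ {P Q : A → Bool} → (∀ x → P x ∧ Q x ≡ false) → ∀ xs →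
    count (λ x → P x ∨ Q x) xs ≡ count P xs ℕ.+ count Q xs
  count-∨-disjoint {P = P} {Q} disjoint xs = begin
    count (λ x → P x ∨ Q x) xs                                  ≡⟨ ℕₚ.+-identityʳ _ ⟨
    count (λ x → P x ∨ Q x) xs ℕ.+ 0                            ≡⟨ cong (count (λ x → P x ∨ Q x) xs ℕ.+_) (count-false disjoint xs) ⟨
    count (λ x → P x ∨ Q x) xs ℕ.+ count (λ x → P x ∧ Q x) xs   ≡⟨ count-∨ P Q xs ⟩
    count P xs ℕ.+ count Q xs                                   ∎
    where open ≡-Reasoning

  count-upTo-≡ᵇ : ∀ {j n} → j ℕ.< n → count (_≡ᵇ j) (upTo n) ≡ 1
  count-upTo-≡ᵇ {zero} {suc n} _ =
    cong suc (trans (cong (count (_≡ᵇ 0)) (sym (Listₚ.map-upTo suc n)))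
                    (trans (count-map (_≡ᵇ 0) suc (upTo n)) (count-false (λ _ → refl) (upTo n))))
  count-upTo-≡ᵇ {suc j} {suc n} (s≤s j<n) =
    trans (cong (count (_≡ᵇ suc j)) (sym (Listₚ.map-upTo suc n)))
          (trans (count-map (_≡ᵇ suc j) suc (upTo n)) (count-upTo-≡ᵇ j<n))

  sumℚ-cong : ∀ {f g : A → ℚ} → (∀ x → f x ≡ g x) → ∀ xs → sumℚ (map f xs) ≡ sumℚ (map g xs)
  sumℚ-cong f≡g []       = refl
  sumℚ-cong f≡g (x ∷ xs) = cong₂ ℚ._+_ (f≡g x) (sumℚ-cong f≡g xs)

  sumℚ-+ : ∀ (f g : A → ℚ) xs → sumℚ (map (λ x → f x ℚ.+ g x) xs) ≡ sumℚ (map f xs) ℚ.+ sumℚ (map g xs)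
  sumℚ-+ f g []       = refl
  sumℚ-+ f g (x ∷ xs) = trans (cong (f x ℚ.+ g x ℚ.+_) (sumℚ-+ f g xs)) (interchange (f x) (g x) _ _)

  sumℚ-filter : ∀ {P : A → Set} (P? : Decidable P) (f : A → ℚ) xs →
    sumℚ (map f (filter P? xs)) ≡ sumℚ (map (λ x → if does (P? x) then f x else 0ℚ) xs)
  sumℚ-filter P? f []       = refl
  sumℚ-filter P? f (x ∷ xs) with does (P? x)
  ... | true  = cong (f x ℚ.+_) (sumℚ-filter P? f xs)
  ... | false = trans (sumℚ-filter P? f xs) (sym (ℚₚ.+-identityˡ _))

  sumℚ-if : ∀ (P : A → Bool) q xs → sumℚ (map (λ x → if P x then q else 0ℚ) xs) ≡ count P xs · q
  sumℚ-if P q []       = refl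
  sumℚ-if P q (x ∷ xs) with P x
  ... | true  = cong (q ℚ.+_) (sumℚ-if P q xs)
  ... | false = trans (ℚₚ.+-identityˡ _) (sumℚ-if P q xs)

  ∣r∣≡ᵇ1+x : ∀ r x → (ℤ.∣ r ∣ ≡ᵇ suc x) ≡ does (r ℤ.≟ + suc x) ∨ does (r ℤ.≟ -[1+ x ])
  ∣r∣≡ᵇ1+x (+ n)    x = sym (∨-identityʳ _)
  ∣r∣≡ᵇ1+x -[1+ n ] x = refl

  N+N+1≡2N+1 : ∀ N → suc (N ℕ.+ N) ≡ 2 ℕ.* N ℕ.+ 1
  N+N+1≡2N+1 = ℕ-Solver.solve-∀

  intRange-index : ∀ N t → ℤ.∣ t ∣ ℕ.≤ N → ∃ λ j → j ℕ.< 2 ℕ.* N ℕ.+ 1 × + j - + N ≡ t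
  intRange-index N (+ n) n≤N = n ℕ.+ N , j<2N+1 , (begin
    + (n ℕ.+ N) - + N   ≡⟨ cong (_- + N) (ℤₚ.pos-+ n N) ⟩
    + n ℤ.+ + N - + N   ≡⟨ identity (+ n) (+ N) ⟩
    + n                 ∎)
    where
    open ≡-Reasoning
    identity : ∀ i j → i ℤ.+ j - j ≡ i
    identity = solve-∀
    j<2N+1 : n ℕ.+ N ℕ.< 2 ℕ.* N ℕ.+ 1
    j<2N+1 = ℕₚ.≤-trans (s≤s (ℕₚ.+-monoˡ-≤ N n≤N)) (ℕₚ.≤-reflexive (N+N+1≡2N+1 N))
  intRange-index N -[1+ n ] 1+n≤N = N ℕ.∸ suc n , j<2N+1 , (begin
    + (N ℕ.∸ suc n) - + N                              ≡⟨ cong (λ i → + (N ℕ.∸ suc n) - i) (sym N∸[1+n]+1+n≡N) ⟩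
    + (N ℕ.∸ suc n) - (+ (N ℕ.∸ suc n) ℤ.+ + suc n)     ≡⟨ identity (+ (N ℕ.∸ suc n)) (+ suc n) ⟩
    -[1+ n ]                                           ∎)
    where
    open ≡-Reasoning
    identity : ∀ i j → i - (i ℤ.+ j) ≡ ℤ.- j
    identity = solve-∀
    N∸[1+n]+1+n≡N : + (N ℕ.∸ suc n) ℤ.+ + suc n ≡ + N
    N∸[1+n]+1+n≡N = trans (sym (ℤₚ.pos-+ (N ℕ.∸ suc n) (suc n))) (cong +_ (ℕₚ.m∸n+n≡m 1+n≤N))
    j<2N+1 : N ℕ.∸ suc n ℕ.< 2 ℕ.* N ℕ.+ 1
    j<2N+1 = ℕₚ.≤-trans (s≤s (ℕₚ.≤-trans (ℕₚ.m∸n≤m N (suc n)) (ℕₚ.m≤m+n N N))) (ℕₚ.≤-reflexive (N+N+1≡2N+1 N))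

  count-intRange-≟ : ∀ N t → ℤ.∣ t ∣ ℕ.≤ N → count (λ r → does (r ℤ.≟ t)) (intRange N) ≡ 1
  count-intRange-≟ N t ∣t∣≤N with intRange-index N t ∣t∣≤N
  ... | j , j<2N+1 , refl = begin
    count (λ r → does (r ℤ.≟ index j)) (map index (upTo (2 ℕ.* N ℕ.+ 1)))
      ≡⟨ count-map (λ r → does (r ℤ.≟ index j)) index (upTo (2 ℕ.* N ℕ.+ 1)) ⟩
    count (λ i → does (index i ℤ.≟ index j)) (upTo (2 ℕ.* N ℕ.+ 1))
      ≡⟨ count-cong index≟index (upTo (2 ℕ.* N ℕ.+ 1)) ⟩
    count (_≡ᵇ j) (upTo (2 ℕ.* N ℕ.+ 1))
      ≡⟨ count-upTo-≡ᵇ j<2N+1 ⟩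
    1 ∎
    where
    open ≡-Reasoning
    index : ℕ → ℤ
    index i = + i - + N
    identity : ∀ i j → i - j ℤ.+ j ≡ i
    identity = solve-∀
    index-injective : ∀ {i k} → index i ≡ index k → i ≡ k
    index-injective {i} {k} eq =
      ℤₚ.+-injective (trans (sym (identity (+ i) (+ N))) (trans (cong (ℤ._+ + N) eq) (identity (+ k) (+ N))))
    index≟index : ∀ i → does (index i ℤ.≟ index j) ≡ (i ≡ᵇ j)
    index≟index i = T⇔T⇒≡ (ℕₚ.≡⇒≡ᵇ i j ∘ index-injective ∘ T-does⇒ (index i ℤ.≟ index j))
                          (⇒T-does (index i ℤ.≟ index j) ∘ cong index ∘ ℕₚ.≡ᵇ⇒≡ i j)

  count-intRange-∣∣≡ᵇ : ∀ N {x} → 0 ℕ.< x → x ℕ.≤ N → count (λ r → ℤ.∣ r ∣ ≡ᵇ x) (intRange N) ≡ 2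
  count-intRange-∣∣≡ᵇ N {suc x} _ x≤N = begin
    count (λ r → ℤ.∣ r ∣ ≡ᵇ suc x) (intRange N)
      ≡⟨ count-cong (λ r → ∣r∣≡ᵇ1+x r x) (intRange N) ⟩
    count (λ r → does (r ℤ.≟ + suc x) ∨ does (r ℤ.≟ -[1+ x ])) (intRange N)
      ≡⟨ count-∨-disjoint disjoint (intRange N) ⟩
    count (λ r → does (r ℤ.≟ + suc x)) (intRange N) ℕ.+ count (λ r → does (r ℤ.≟ -[1+ x ])) (intRange N)
      ≡⟨ cong₂ ℕ._+_ (count-intRange-≟ N (+ suc x) x≤N) (count-intRange-≟ N -[1+ x ] x≤N) ⟩
    2 ∎
    where
    open ≡-Reasoning
    disjoint : ∀ r → does (r ℤ.≟ + suc x) ∧ does (r ℤ.≟ -[1+ x ]) ≡ false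
    disjoint (+ n)    = ∧-zeroʳ _
    disjoint -[1+ n ] = refl

  count-intRange-∣∣≡ᵇ-pair : ∀ N {x y} → x ≢ y → 0 ℕ.< x → 0 ℕ.< y → x ℕ.≤ N → y ℕ.≤ N →
    count (λ r → (ℤ.∣ r ∣ ≡ᵇ x) ∨ (ℤ.∣ r ∣ ≡ᵇ y)) (intRange N) ≡ 4
  count-intRange-∣∣≡ᵇ-pair N {x} {y} x≢y 0<x 0<y x≤N y≤N =
    trans (count-∨-disjoint disjoint (intRange N))
          (cong₂ ℕ._+_ (count-intRange-∣∣≡ᵇ N 0<x x≤N) (count-intRange-∣∣≡ᵇ N 0<y y≤N))
    where
    disjoint : ∀ r → (ℤ.∣ r ∣ ≡ᵇ x) ∧ (ℤ.∣ r ∣ ≡ᵇ y) ≡ false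
    disjoint r = T⇔T⇒≡ (λ both → x≢y (trans (sym (∣r∣≡ (proj₁ (split both)))) (∣r∣≡ (proj₂ (split both))))) λ ()
      where
      split : T ((ℤ.∣ r ∣ ≡ᵇ x) ∧ (ℤ.∣ r ∣ ≡ᵇ y)) → T (ℤ.∣ r ∣ ≡ᵇ x) × T (ℤ.∣ r ∣ ≡ᵇ y)
      split = Equivalence.to T-∧
      ∣r∣≡ : ∀ {z} → T (ℤ.∣ r ∣ ≡ᵇ z) → ℤ.∣ r ∣ ≡ z
      ∣r∣≡ {z} = ℕₚ.≡ᵇ⇒≡ ℤ.∣ r ∣ z

-- Evaluating the sum
module _ where

  open import Data.Bool using (Bool; true; false; T; not; _∧_; _∨_; if_then_else_)
  open import Data.Bool.Properties using (T-∧; T-∨; T-not-≡)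
  open import Data.Nat as ℕ using (ℕ; z≤n; s≤s; _≡ᵇ_)
  import Data.Nat.Properties as ℕₚ
  import Data.Nat.Divisibility as ℕ
  open import Data.Nat.Primality using (Prime; prime[2]; euclidsLemma; prime⇒irreducible)
  import Data.Nat.Tactic.RingSolver as ℕ-Solver
  open import Data.Integer as ℤ using (ℤ; +_; _+_; _-_; _*_; -_)
  open import Data.Integer.Properties using (_<?_)
  import Data.Integer.Properties as ℤₚ
  open import Data.Integer.Tactic.RingSolver using (solve-∀)
  open import Data.Rational as ℚ using (ℚ; 0ℚ; _/_)
  open import Algebra.Definitions.RawMonoid ℚ.+-0-rawMonoid using () renaming (_×_ to _·_)
  open import Data.List using (List; map; filter)
  import Data.List.Properties as Listₚ
  open import Data.List.Relation.Unary.Any using (Any; any?; satisfied)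
  import Data.List.Relation.Unary.Any.Properties as Anyₚ
  open import Data.Product using (∃; ∃₂; _×_; _,_; proj₁; proj₂)
  open import Data.Sum using (_⊎_; inj₁; inj₂; [_,_]′)
  open import Data.Empty using (⊥; ⊥-elim)
  open import Function using (id; _∘_)
  open import Function.Bundles using (Equivalence)
  open import Relation.Nullary using (Dec; does)
  open import Relation.Nullary.Decidable using (from-no)
  open import Relation.Binary.PropositionalEquality

  private
    variable
      p : ℕ

  x-y≡-z⇒x+z≡y : ∀ {x y z : ℤ} → x - y ≡ - z → x + z ≡ y
  x-y≡-z⇒x+z≡y {x} {y} {z} eq = begin
    x + z           ≡⟨ identity x y z ⟩
    x - y + z + y   ≡⟨ cong (λ w → w + z + y) eq ⟩
    - z + z + y     ≡⟨ identity′ y z ⟩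
    y               ∎
    where
    open ≡-Reasoning
    identity : ∀ x y z → x + z ≡ x - y + z + y
    identity = solve-∀
    identity′ : ∀ y z → - z + z + y ≡ y
    identity′ = solve-∀

  x+z≡y⇒x-y≡-z : ∀ {x y z : ℤ} → x + z ≡ y → x - y ≡ - z
  x+z≡y⇒x-y≡-z {x} {y} {z} eq = trans (cong (λ w → x - w) (sym eq)) (identity x z)
    where
    identity : ∀ x z → x - (x + z) ≡ - z
    identity = solve-∀

  hasForm-sound : ∀ k p r → T (hasForm k p r) → ∃ λ α → ℤ.∣ r ∣ ℕ.* ℤ.∣ r ∣ ℕ.+ k ℕ.* (α ℕ.* α) ≡ 4 ℕ.* p
  hasForm-sound k p r form with satisfied (T-does⇒ (any? _ (intRange (4 ℕ.* p))) form)
  ... | α , eq = ℤ.∣ α ∣ , ℤₚ.+-injective (begin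
    + (ℤ.∣ r ∣ ℕ.* ℤ.∣ r ∣ ℕ.+ k ℕ.* (ℤ.∣ α ∣ ℕ.* ℤ.∣ α ∣)) ≡⟨ pos-∣u∣²+d∣v∣² r k α ⟩
    r * r + + k * (α * α)                                  ≡⟨ x-y≡-z⇒x+z≡y {r * r} {+ (4 ℕ.* p)} {+ k * (α * α)} eq ⟩
    + (4 ℕ.* p) ∎)
    where open ≡-Reasoning

  hasForm-complete : ∀ k p r α → 0 ℕ.< k → ℤ.∣ r ∣ ℕ.* ℤ.∣ r ∣ ℕ.+ k ℕ.* (α ℕ.* α) ≡ 4 ℕ.* p → T (hasForm k p r)
  hasForm-complete k p r α 0<k eq =
    ⇒T-does (any? (λ β → sq r - + (4 ℕ.* p) ℤ.≟ - (+ k * sq β)) (intRange (4 ℕ.* p))) (fromIndex (intRange-index (4 ℕ.* p) (+ α) α≤4p))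
    where
    Solution : ℤ → Set
    Solution β = sq r - + (4 ℕ.* p) ≡ - (+ k * sq β)
    α≤4p : α ℕ.≤ 4 ℕ.* p
    α≤4p = ℕₚ.≤-trans (m≤m*m α) (ℕₚ.≤-trans (ℕₚ.m≤n*m (α ℕ.* α) k {{ℕ.>-nonZero 0<k}})
             (subst (k ℕ.* (α ℕ.* α) ℕ.≤_) eq (ℕₚ.m≤n+m (k ℕ.* (α ℕ.* α)) (ℤ.∣ r ∣ ℕ.* ℤ.∣ r ∣))))
    solution : Solution (+ α)
    solution = x+z≡y⇒x-y≡-z {r * r} {+ (4 ℕ.* p)} {+ k * (+ α * + α)} (trans (sym (pos-∣u∣²+d∣v∣² r k (+ α))) (cong +_ eq))
    fromIndex : (∃ λ j → j ℕ.< 2 ℕ.* (4 ℕ.* p) ℕ.+ 1 × + j - + (4 ℕ.* p) ≡ + α) → Any Solution (intRange (4 ℕ.* p))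
    fromIndex (j , j<M , index≡α) =
      subst (Any Solution) (sym (Listₚ.map-upTo (λ i → + i - + (4 ℕ.* p)) (2 ℕ.* (4 ℕ.* p) ℕ.+ 1)))
        (Anyₚ.applyUpTo⁺ (λ i → + i - + (4 ℕ.* p)) (subst Solution (sym index≡α) solution) j<M)

  ⇒small : ∀ p r → ℤ.∣ r ∣ ℕ.* ℤ.∣ r ∣ ℕ.< 4 ℕ.* p → T (does (sq r <? + (4 ℕ.* p)))
  ⇒small p r r²<4p = ⇒T-does (sq r <? + (4 ℕ.* p)) (subst (ℤ._< + (4 ℕ.* p)) (sym (i*i≡+∣i∣*∣i∣ r)) (ℤ.+<+ r²<4p))

  even⇒ : ∀ r → T (does (2 ℕ.∣? ℤ.∣ r ∣)) → ∃ λ s → ℤ.∣ r ∣ ≡ 2 ℕ.* s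
  even⇒ r even with T-does⇒ (2 ℕ.∣? ℤ.∣ r ∣) even
  ... | ℕ.divides s ∣r∣≡s*2 = s , trans ∣r∣≡s*2 (ℕₚ.*-comm s 2)

  ⇒even : ∀ r s → ℤ.∣ r ∣ ≡ 2 ℕ.* s → T (does (2 ℕ.∣? ℤ.∣ r ∣))
  ⇒even r s ∣r∣≡2s = ⇒T-does (2 ℕ.∣? ℤ.∣ r ∣) (ℕ.divides s (trans ∣r∣≡2s (ℕₚ.*-comm 2 s)))

  hasForm4⇒ : ∀ p r s → ℤ.∣ r ∣ ≡ 2 ℕ.* s → T (hasForm 4 p r) → ∃ λ α → s ℕ.* s ℕ.+ α ℕ.* α ≡ p
  hasForm4⇒ p r s ∣r∣≡2s form = fromSolution (hasForm-sound 4 p r form)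
    where
    identity : ∀ s α → 4 ℕ.* (s ℕ.* s ℕ.+ α ℕ.* α) ≡ 2 ℕ.* s ℕ.* (2 ℕ.* s) ℕ.+ 4 ℕ.* (α ℕ.* α)
    identity = ℕ-Solver.solve-∀
    fromSolution : (∃ λ α → ℤ.∣ r ∣ ℕ.* ℤ.∣ r ∣ ℕ.+ 4 ℕ.* (α ℕ.* α) ≡ 4 ℕ.* p) → ∃ λ α → s ℕ.* s ℕ.+ α ℕ.* α ≡ p
    fromSolution (α , eq) = α , ℕₚ.*-cancelˡ-≡ (s ℕ.* s ℕ.+ α ℕ.* α) p 4
      (trans (identity s α) (subst (λ x → x ℕ.* x ℕ.+ 4 ℕ.* (α ℕ.* α) ≡ 4 ℕ.* p) ∣r∣≡2s eq))

  ⇒hasForm4 : ∀ p r s α → ℤ.∣ r ∣ ≡ 2 ℕ.* s → s ℕ.* s ℕ.+ α ℕ.* α ≡ p → T (hasForm 4 p r)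
  ⇒hasForm4 p r s α ∣r∣≡2s s²+α²≡p = hasForm-complete 4 p r α (s≤s z≤n) (begin
    ℤ.∣ r ∣ ℕ.* ℤ.∣ r ∣ ℕ.+ 4 ℕ.* (α ℕ.* α)   ≡⟨ cong (λ x → x ℕ.* x ℕ.+ 4 ℕ.* (α ℕ.* α)) ∣r∣≡2s ⟩
    2 ℕ.* s ℕ.* (2 ℕ.* s) ℕ.+ 4 ℕ.* (α ℕ.* α) ≡⟨ identity s α ⟩
    4 ℕ.* (s ℕ.* s ℕ.+ α ℕ.* α)             ≡⟨ cong (4 ℕ.*_) s²+α²≡p ⟩
    4 ℕ.* p                                 ∎)
    where
    open ≡-Reasoning
    identity : ∀ s α → 2 ℕ.* s ℕ.* (2 ℕ.* s) ℕ.+ 4 ℕ.* (α ℕ.* α) ≡ 4 ℕ.* (s ℕ.* s ℕ.+ α ℕ.* α)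
    identity = ℕ-Solver.solve-∀

  -- Here the α of the definition is 2β: 3α² = 4(p - s²) forces α to be even.
  hasForm3⇒ : ∀ p r s → ℤ.∣ r ∣ ≡ 2 ℕ.* s → T (hasForm 3 p r) → ∃ λ β → s ℕ.* s ℕ.+ 3 ℕ.* (β ℕ.* β) ≡ p
  hasForm3⇒ p r s ∣r∣≡2s form = fromSolution (hasForm-sound 3 p r form)
    where
    fromSolution : (∃ λ α → ℤ.∣ r ∣ ℕ.* ℤ.∣ r ∣ ℕ.+ 3 ℕ.* (α ℕ.* α) ≡ 4 ℕ.* p) →
                   ∃ λ β → s ℕ.* s ℕ.+ 3 ℕ.* (β ℕ.* β) ≡ p
    fromSolution (α , eq) = β , ℕₚ.*-cancelˡ-≡ (s ℕ.* s ℕ.+ 3 ℕ.* (β ℕ.* β)) p 4 (begin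
      4 ℕ.* (s ℕ.* s ℕ.+ 3 ℕ.* (β ℕ.* β))          ≡⟨ identity s β ⟩
      2 ℕ.* s ℕ.* (2 ℕ.* s) ℕ.+ 3 ℕ.* (β ℕ.* 2 ℕ.* (β ℕ.* 2)) ≡⟨ cong (λ a → 2 ℕ.* s ℕ.* (2 ℕ.* s) ℕ.+ 3 ℕ.* (a ℕ.* a)) (sym α≡2β) ⟩
      2 ℕ.* s ℕ.* (2 ℕ.* s) ℕ.+ 3 ℕ.* (α ℕ.* α)      ≡⟨ eq′ ⟩
      4 ℕ.* p                                        ∎)
      where
      open ≡-Reasoning
      identity : ∀ s β → 4 ℕ.* (s ℕ.* s ℕ.+ 3 ℕ.* (β ℕ.* β)) ≡ 2 ℕ.* s ℕ.* (2 ℕ.* s) ℕ.+ 3 ℕ.* (β ℕ.* 2 ℕ.* (β ℕ.* 2))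
      identity = ℕ-Solver.solve-∀
      eq′ : 2 ℕ.* s ℕ.* (2 ℕ.* s) ℕ.+ 3 ℕ.* (α ℕ.* α) ≡ 4 ℕ.* p
      eq′ = subst (λ x → x ℕ.* x ℕ.+ 3 ℕ.* (α ℕ.* α) ≡ 4 ℕ.* p) ∣r∣≡2s eq
      2∣3α² : 2 ℕ.∣ 3 ℕ.* (α ℕ.* α)
      2∣3α² = ℕ.∣m+n∣m⇒∣n (subst (2 ℕ.∣_) (sym eq′) (ℕ.∣m⇒∣m*n p (ℕ.divides 2 refl)))
                           (ℕ.∣m⇒∣m*n (2 ℕ.* s) (ℕ.m∣m*n s))
      2∣α : 2 ℕ.∣ α
      2∣α = [ ⊥-elim ∘ from-no (2 ℕ.∣? 3) , [ id , id ]′ ∘ euclidsLemma α α prime[2] ]′ (euclidsLemma 3 (α ℕ.* α) prime[2] 2∣3α²)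
      β : ℕ
      β = ℕ.quotient 2∣α
      α≡2β : α ≡ β ℕ.* 2
      α≡2β = ℕ.m∣n⇒n≡quotient*m 2∣α

  ⇒hasForm3 : ∀ p r s β → ℤ.∣ r ∣ ≡ 2 ℕ.* s → s ℕ.* s ℕ.+ 3 ℕ.* (β ℕ.* β) ≡ p → T (hasForm 3 p r)
  ⇒hasForm3 p r s β ∣r∣≡2s s²+3β²≡p = hasForm-complete 3 p r (2 ℕ.* β) (s≤s z≤n) (begin
    ℤ.∣ r ∣ ℕ.* ℤ.∣ r ∣ ℕ.+ 3 ℕ.* (2 ℕ.* β ℕ.* (2 ℕ.* β)) ≡⟨ cong (λ x → x ℕ.* x ℕ.+ 3 ℕ.* (2 ℕ.* β ℕ.* (2 ℕ.* β))) ∣r∣≡2s ⟩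
    2 ℕ.* s ℕ.* (2 ℕ.* s) ℕ.+ 3 ℕ.* (2 ℕ.* β ℕ.* (2 ℕ.* β)) ≡⟨ identity s β ⟩
    4 ℕ.* (s ℕ.* s ℕ.+ 3 ℕ.* (β ℕ.* β))                     ≡⟨ cong (4 ℕ.*_) s²+3β²≡p ⟩
    4 ℕ.* p                                                 ∎)
    where
    open ≡-Reasoning
    identity : ∀ s β → 2 ℕ.* s ℕ.* (2 ℕ.* s) ℕ.+ 3 ℕ.* (2 ℕ.* β ℕ.* (2 ℕ.* β)) ≡ 4 ℕ.* (s ℕ.* s ℕ.+ 3 ℕ.* (β ℕ.* β))
    identity = ℕ-Solver.solve-∀

  contributes½ contributes⅔ : ℕ → ℤ → Bool
  contributes½ p r = does (sq r <? + (4 ℕ.* p)) ∧ (does (2 ℕ.∣? ℤ.∣ r ∣) ∧ hasForm 4 p r)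
  contributes⅔ p r = does (sq r <? + (4 ℕ.* p)) ∧ (does (2 ℕ.∣? ℤ.∣ r ∣) ∧ (not (hasForm 4 p r) ∧ hasForm 3 p r))

  S≡counts : ∀ p {m n} → count (contributes½ p) (intRange (4 ℕ.* p)) ≡ m → count (contributes⅔ p) (intRange (4 ℕ.* p)) ≡ n →
    S p ≡ m · (+ 1 / 2) ℚ.+ n · (+ 2 / 3)
  S≡counts p {m} {n} count½≡m count⅔≡n = begin
    S p
      ≡⟨ sumℚ-filter (λ r → 2 ℕ.∣? ℤ.∣ r ∣) (λ r → c r p) (filter small? range) ⟩
    sumℚ (map (λ r → if even r then c r p else 0ℚ) (filter small? range))
      ≡⟨ sumℚ-filter small? (λ r → if even r then c r p else 0ℚ) range ⟩
    sumℚ (map (λ r → if does (small? r) then (if even r then c r p else 0ℚ) else 0ℚ) range)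
      ≡⟨ sumℚ-cong split range ⟩
    sumℚ (map (λ r → (if contributes½ p r then + 1 / 2 else 0ℚ) ℚ.+ (if contributes⅔ p r then + 2 / 3 else 0ℚ)) range)
      ≡⟨ sumℚ-+ (λ r → if contributes½ p r then + 1 / 2 else 0ℚ) (λ r → if contributes⅔ p r then + 2 / 3 else 0ℚ) range ⟩
    sumℚ (map (λ r → if contributes½ p r then + 1 / 2 else 0ℚ) range) ℚ.+ sumℚ (map (λ r → if contributes⅔ p r then + 2 / 3 else 0ℚ) range)
      ≡⟨ cong₂ ℚ._+_ (sumℚ-if (contributes½ p) (+ 1 / 2) range) (sumℚ-if (contributes⅔ p) (+ 2 / 3) range) ⟩
    count (contributes½ p) range · (+ 1 / 2) ℚ.+ count (contributes⅔ p) range · (+ 2 / 3)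
      ≡⟨ cong₂ (λ m n → m · (+ 1 / 2) ℚ.+ n · (+ 2 / 3)) count½≡m count⅔≡n ⟩
    m · (+ 1 / 2) ℚ.+ n · (+ 2 / 3) ∎
    where
    open ≡-Reasoning
    range : List ℤ
    range = intRange (4 ℕ.* p)
    small? : ∀ r → Dec (sq r ℤ.< + (4 ℕ.* p))
    small? r = sq r <? + (4 ℕ.* p)
    even : ℤ → Bool
    even r = does (2 ℕ.∣? ℤ.∣ r ∣)
    split : ∀ r → (if does (small? r) then (if even r then c r p else 0ℚ) else 0ℚ)
                ≡ (if contributes½ p r then + 1 / 2 else 0ℚ) ℚ.+ (if contributes⅔ p r then + 2 / 3 else 0ℚ)
    split r with does (small? r) | even r | hasForm 4 p r | hasForm 3 p r
    ... | true  | true  | true  | _     = refl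
    ... | true  | true  | false | true  = refl
    ... | true  | true  | false | false = refl
    ... | true  | false | _     | _     = refl
    ... | false | _     | _     | _     = refl

  ∣r∣²<4p : ∀ p r s k β → 0 ℕ.< k → Prime p → ℤ.∣ r ∣ ≡ 2 ℕ.* s → s ℕ.* s ℕ.+ k ℕ.* (β ℕ.* β) ≡ p →
            ℤ.∣ r ∣ ℕ.* ℤ.∣ r ∣ ℕ.< 4 ℕ.* p
  ∣r∣²<4p p r s k β 0<k pp ∣r∣≡2s eq = begin-strict
    ℤ.∣ r ∣ ℕ.* ℤ.∣ r ∣   ≡⟨ cong (λ x → x ℕ.* x) ∣r∣≡2s ⟩
    2 ℕ.* s ℕ.* (2 ℕ.* s) ≡⟨ identity s ⟩
    4 ℕ.* (s ℕ.* s)       <⟨ ℕₚ.*-monoʳ-< 4 s²<p ⟩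
    4 ℕ.* p               ∎
    where
    open ℕₚ.≤-Reasoning
    identity : ∀ s → 2 ℕ.* s ℕ.* (2 ℕ.* s) ≡ 4 ℕ.* (s ℕ.* s)
    identity = ℕ-Solver.solve-∀
    0<β : 0 ℕ.< β
    0<β = representation⇒0<b pp k s β eq
    s²<p : s ℕ.* s ℕ.< p
    s²<p = subst (s ℕ.* s ℕ.<_) eq (ℕₚ.m<m+n (s ℕ.* s) (ℕₚ.*-mono-< 0<k (ℕₚ.*-mono-< 0<β 0<β)))

  contributes½⇒ : ∀ p r → T (contributes½ p r) → ∃₂ λ s α → ℤ.∣ r ∣ ≡ 2 ℕ.* s × s ℕ.* s ℕ.+ α ℕ.* α ≡ p
  contributes½⇒ p r c½ = fromEven (even⇒ r (proj₁ even,form))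
    where
    even,form : T (does (2 ℕ.∣? ℤ.∣ r ∣)) × T (hasForm 4 p r)
    even,form = Equivalence.to T-∧ (proj₂ (Equivalence.to (T-∧ {does (sq r <? + (4 ℕ.* p))}) c½))
    fromEven : (∃ λ s → ℤ.∣ r ∣ ≡ 2 ℕ.* s) → ∃₂ λ s α → ℤ.∣ r ∣ ≡ 2 ℕ.* s × s ℕ.* s ℕ.+ α ℕ.* α ≡ p
    fromEven (s , ∣r∣≡2s) = s , proj₁ solution , ∣r∣≡2s , proj₂ solution
      where
      solution : ∃ λ α → s ℕ.* s ℕ.+ α ℕ.* α ≡ p
      solution = hasForm4⇒ p r s ∣r∣≡2s (proj₂ even,form)

  ⇒contributes½ : Prime p → ∀ r s α → ℤ.∣ r ∣ ≡ 2 ℕ.* s → s ℕ.* s ℕ.+ α ℕ.* α ≡ p → T (contributes½ p r)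
  ⇒contributes½ {p} pp r s α ∣r∣≡2s s²+α²≡p =
    Equivalence.from T-∧ (⇒small p r (∣r∣²<4p p r s 1 α (s≤s z≤n) pp ∣r∣≡2s (a²+b²≡n⇒a²+1b²≡n s α s²+α²≡p)) ,
    Equivalence.from T-∧ (⇒even r s ∣r∣≡2s , ⇒hasForm4 p r s α ∣r∣≡2s s²+α²≡p))

  contributes⅔⇒ : ∀ p r → T (contributes⅔ p r) → ∃₂ λ s β → ℤ.∣ r ∣ ≡ 2 ℕ.* s × s ℕ.* s ℕ.+ 3 ℕ.* (β ℕ.* β) ≡ p
  contributes⅔⇒ p r c⅔ = fromEven (even⇒ r (proj₁ even,rest))
    where
    even,rest : T (does (2 ℕ.∣? ℤ.∣ r ∣)) × T (not (hasForm 4 p r) ∧ hasForm 3 p r)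
    even,rest = Equivalence.to T-∧ (proj₂ (Equivalence.to (T-∧ {does (sq r <? + (4 ℕ.* p))}) c⅔))
    form : T (hasForm 3 p r)
    form = proj₂ (Equivalence.to (T-∧ {not (hasForm 4 p r)}) (proj₂ even,rest))
    fromEven : (∃ λ s → ℤ.∣ r ∣ ≡ 2 ℕ.* s) → ∃₂ λ s β → ℤ.∣ r ∣ ≡ 2 ℕ.* s × s ℕ.* s ℕ.+ 3 ℕ.* (β ℕ.* β) ≡ p
    fromEven (s , ∣r∣≡2s) = s , proj₁ solution , ∣r∣≡2s , proj₂ solution
      where
      solution : ∃ λ β → s ℕ.* s ℕ.+ 3 ℕ.* (β ℕ.* β) ≡ p
      solution = hasForm3⇒ p r s ∣r∣≡2s form

  ⇒contributes⅔ : Prime p → ∀ r s β → ℤ.∣ r ∣ ≡ 2 ℕ.* s → s ℕ.* s ℕ.+ 3 ℕ.* (β ℕ.* β) ≡ p → T (contributes⅔ p r)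
  ⇒contributes⅔ {p} pp r s β ∣r∣≡2s s²+3β²≡p =
    Equivalence.from T-∧ (⇒small p r (∣r∣²<4p p r s 3 β (s≤s z≤n) pp ∣r∣≡2s s²+3β²≡p) ,
    Equivalence.from T-∧ (⇒even r s ∣r∣≡2s ,
    Equivalence.from T-∧ (Equivalence.from T-not-≡ noForm4 , ⇒hasForm3 p r s β ∣r∣≡2s s²+3β²≡p)))
    where
    noForm4 : hasForm 4 p r ≡ false
    noForm4 = T⇔T⇒≡ (refute ∘ hasForm4⇒ p r s ∣r∣≡2s) λ ()
      where
      refute : (∃ λ α → s ℕ.* s ℕ.+ α ℕ.* α ≡ p) → ⊥
      refute (α , s²+α²≡p) = noCommonFirstSquare pp s α β s²+α²≡p s²+3β²≡p

  2a≤4p : ∀ a k b → a ℕ.* a ℕ.+ k ℕ.* (b ℕ.* b) ≡ p → 2 ℕ.* a ℕ.≤ 4 ℕ.* p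
  2a≤4p {p} a k b eq = ℕₚ.*-mono-≤ {2} {4} (s≤s (s≤s z≤n))
    (ℕₚ.≤-trans (m≤m*m a) (subst (a ℕ.* a ℕ.≤_) eq (ℕₚ.m≤m+n (a ℕ.* a) (k ℕ.* (b ℕ.* b)))))

  count½≡4 : Prime p → 3 ℕ.< p → p ℕ.% 4 ≡ 1 → count (contributes½ p) (intRange (4 ℕ.* p)) ≡ 4
  count½≡4 {p} pp 3<p p%4≡1 = fromSquares (sumOfTwoSquares pp p%4≡1)
    where
    fromSquares : (∃₂ λ a b → a ℕ.* a ℕ.+ b ℕ.* b ≡ p) → count (contributes½ p) (intRange (4 ℕ.* p)) ≡ 4
    fromSquares (a , b , a²+b²≡p) = trans (count-cong characterisation (intRange (4 ℕ.* p)))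
      (count-intRange-∣∣≡ᵇ-pair (4 ℕ.* p) 2a≢2b (ℕₚ.*-monoʳ-< 2 0<a) (ℕₚ.*-monoʳ-< 2 0<b)
                                (2a≤4p a 1 b a²+1b²≡p) (2a≤4p b 1 a b²+1a²≡p))
      where
      b²+a²≡p : b ℕ.* b ℕ.+ a ℕ.* a ≡ p
      b²+a²≡p = trans (ℕₚ.+-comm (b ℕ.* b) (a ℕ.* a)) a²+b²≡p
      a²+1b²≡p : a ℕ.* a ℕ.+ 1 ℕ.* (b ℕ.* b) ≡ p
      a²+1b²≡p = a²+b²≡n⇒a²+1b²≡n a b a²+b²≡p
      b²+1a²≡p : b ℕ.* b ℕ.+ 1 ℕ.* (a ℕ.* a) ≡ p
      b²+1a²≡p = a²+b²≡n⇒a²+1b²≡n b a b²+a²≡p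
      0<a : 0 ℕ.< a
      0<a = representation⇒0<b pp 1 b a b²+1a²≡p
      0<b : 0 ℕ.< b
      0<b = representation⇒0<b pp 1 a b a²+1b²≡p
      2a≢2b : 2 ℕ.* a ≢ 2 ℕ.* b
      2a≢2b 2a≡2b with prime⇒irreducible pp (ℕ.divides (a ℕ.* a) p≡a²*2)
        where
        identity : ∀ x → x ℕ.+ x ≡ x ℕ.* 2
        identity = ℕ-Solver.solve-∀
        p≡a²*2 : p ≡ a ℕ.* a ℕ.* 2
        p≡a²*2 = trans (sym a²+b²≡p) (trans (cong (λ b → a ℕ.* a ℕ.+ b ℕ.* b) (sym (ℕₚ.*-cancelˡ-≡ a b 2 2a≡2b))) (identity (a ℕ.* a)))
      ... | inj₂ 2≡p = ℕₚ.<⇒≢ (ℕₚ.<-trans (ℕₚ.n<1+n 2) 3<p) 2≡p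
      characterisation : ∀ r → contributes½ p r ≡ (ℤ.∣ r ∣ ≡ᵇ 2 ℕ.* a) ∨ (ℤ.∣ r ∣ ≡ᵇ 2 ℕ.* b)
      characterisation r = T⇔T⇒≡ (sound ∘ contributes½⇒ p r) (complete ∘ Equivalence.to T-∨)
        where
        sound : (∃₂ λ s α → ℤ.∣ r ∣ ≡ 2 ℕ.* s × s ℕ.* s ℕ.+ α ℕ.* α ≡ p) →
                T ((ℤ.∣ r ∣ ≡ᵇ 2 ℕ.* a) ∨ (ℤ.∣ r ∣ ≡ᵇ 2 ℕ.* b))
        sound (s , α , ∣r∣≡2s , s²+α²≡p) with sumOfTwoSquares-unique pp a b s α a²+b²≡p s²+α²≡p
        ... | inj₁ s≡a = Equivalence.from T-∨ (inj₁ (ℕₚ.≡⇒≡ᵇ ℤ.∣ r ∣ (2 ℕ.* a) (trans ∣r∣≡2s (cong (2 ℕ.*_) s≡a))))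
        ... | inj₂ s≡b = Equivalence.from T-∨ (inj₂ (ℕₚ.≡⇒≡ᵇ ℤ.∣ r ∣ (2 ℕ.* b) (trans ∣r∣≡2s (cong (2 ℕ.*_) s≡b))))
        complete : T (ℤ.∣ r ∣ ≡ᵇ 2 ℕ.* a) ⊎ T (ℤ.∣ r ∣ ≡ᵇ 2 ℕ.* b) → T (contributes½ p r)
        complete (inj₁ ∣r∣≡ᵇ2a) = ⇒contributes½ pp r a b (ℕₚ.≡ᵇ⇒≡ ℤ.∣ r ∣ (2 ℕ.* a) ∣r∣≡ᵇ2a) a²+b²≡p
        complete (inj₂ ∣r∣≡ᵇ2b) = ⇒contributes½ pp r b a (ℕₚ.≡ᵇ⇒≡ ℤ.∣ r ∣ (2 ℕ.* b) ∣r∣≡ᵇ2b) b²+a²≡p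

  count½≡0 : ∀ p → p ℕ.% 4 ≡ 3 → count (contributes½ p) (intRange (4 ℕ.* p)) ≡ 0
  count½≡0 p p%4≡3 = count-false (λ r → ¬T⇒≡false (refute {r} ∘ contributes½⇒ p r)) (intRange (4 ℕ.* p))
    where
    refute : ∀ {r} → (∃₂ λ s α → ℤ.∣ r ∣ ≡ 2 ℕ.* s × s ℕ.* s ℕ.+ α ℕ.* α ≡ p) → ⊥
    refute (s , α , _ , s²+α²≡p) = a²+b²%4≢3 s α (trans (cong (ℕ._% 4) s²+α²≡p) p%4≡3)

  count⅔≡2 : Prime p → 3 ℕ.< p → p ℕ.% 3 ≡ 1 → count (contributes⅔ p) (intRange (4 ℕ.* p)) ≡ 2
  count⅔≡2 {p} pp 3<p p%3≡1 = fromSquares (sumOfSquareAndThreeSquares pp 3<p p%3≡1)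
    where
    fromSquares : (∃₂ λ a b → a ℕ.* a ℕ.+ 3 ℕ.* (b ℕ.* b) ≡ p) → count (contributes⅔ p) (intRange (4 ℕ.* p)) ≡ 2
    fromSquares (a , b , a²+3b²≡p) = trans (count-cong characterisation (intRange (4 ℕ.* p)))
      (count-intRange-∣∣≡ᵇ (4 ℕ.* p) (ℕₚ.*-monoʳ-< 2 (representation⇒0<a pp 3<p a b a²+3b²≡p)) (2a≤4p a 3 b a²+3b²≡p))
      where
      characterisation : ∀ r → contributes⅔ p r ≡ (ℤ.∣ r ∣ ≡ᵇ 2 ℕ.* a)
      characterisation r = T⇔T⇒≡ (sound ∘ contributes⅔⇒ p r) (complete ∘ ℕₚ.≡ᵇ⇒≡ ℤ.∣ r ∣ (2 ℕ.* a))
        where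
        sound : (∃₂ λ s β → ℤ.∣ r ∣ ≡ 2 ℕ.* s × s ℕ.* s ℕ.+ 3 ℕ.* (β ℕ.* β) ≡ p) → T (ℤ.∣ r ∣ ≡ᵇ 2 ℕ.* a)
        sound (s , β , ∣r∣≡2s , s²+3β²≡p) = ℕₚ.≡⇒≡ᵇ ℤ.∣ r ∣ (2 ℕ.* a)
          (trans ∣r∣≡2s (cong (2 ℕ.*_) (sumOfSquareAndThreeSquares-unique pp 3<p a b s β a²+3b²≡p s²+3β²≡p)))
        complete : ℤ.∣ r ∣ ≡ 2 ℕ.* a → T (contributes⅔ p r)
        complete ∣r∣≡2a = ⇒contributes⅔ pp r a b ∣r∣≡2a a²+3b²≡p

  count⅔≡0 : ∀ p → p ℕ.% 3 ≡ 2 → count (contributes⅔ p) (intRange (4 ℕ.* p)) ≡ 0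
  count⅔≡0 p p%3≡2 = count-false (λ r → ¬T⇒≡false (refute {r} ∘ contributes⅔⇒ p r)) (intRange (4 ℕ.* p))
    where
    refute : ∀ {r} → (∃₂ λ s β → ℤ.∣ r ∣ ≡ 2 ℕ.* s × s ℕ.* s ℕ.+ 3 ℕ.* (β ℕ.* β) ≡ p) → ⊥
    refute (s , β , _ , s²+3β²≡p) = a²+3b²%3≢2 s β (trans (cong (ℕ._% 3) s²+3β²≡p) p%3≡2)


mainTheorem8 : (p : ℕ) → Prime p → 3 < p →
    ((p % 12 ≡ 1 → S p ≡ + 10 / 3) ×
     (p % 12 ≡ 5 → S p ≡ + 2 / 1) ×
     (p % 12 ≡ 7 → S p ≡ + 4 / 3) ×
     (p % 12 ≡ 11 → S p ≡ 0ℚ))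
-- The four right-hand sides are 4 · ½ + 2 · ⅔, 4 · ½ + 0 · ⅔, 0 · ½ + 2 · ⅔ and 0 · ½ + 0 · ⅔.
mainTheorem8 p pp 3<p =
  (λ p≡1  → S≡counts p (count½≡4 pp 3<p (%12⇒%4 {p} p≡1)) (count⅔≡2 pp 3<p (%12⇒%3 {p} p≡1))) ,
  (λ p≡5  → S≡counts p (count½≡4 pp 3<p (%12⇒%4 {p} p≡5)) (count⅔≡0 p (%12⇒%3 {p} p≡5))) ,
  (λ p≡7  → S≡counts p (count½≡0 p (%12⇒%4 {p} p≡7)) (count⅔≡2 pp 3<p (%12⇒%3 {p} p≡7))) ,
  (λ p≡11 → S≡counts p (count½≡0 p (%12⇒%4 {p} p≡11)) (count⅔≡0 p (%12⇒%3 {p} p≡11)))
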